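{- For any partition $\lambda$ and any integer $k\ge1$, writing $G_\lambda(q)=\sum_n a_nq^n$, the sequence $a_0,a_1,\ldots,a_{\lceil k\lambda_k/2\rceil}$ is weakly increasing.
   Context: $\lambda_k$ denotes the $k$-th largest part of $\lambda$ (taken to be $0$ if $\lambda$ has fewer than $k$ parts). For partitions $\mu,\lambda$, $\mu\subseteq\lambda$ means $\mu_i\le\lambda_i$ for all $i$. $G_\lambda(q)=\sum_n a_nq^n$ where $a_n$ is the number of partitions $\mu\subseteq\lambda$ (including the empty partition) with $|\mu|=n$, $|\mu|$ being the sum of parts. -}

module Defs where

open import Data.Nat using (ℕ; zero; suc; _≤_; _<_; _≥_; _⊓_)
open import Data.List using (List; []; _∷_; [_]; map; concatMap; upTo; filter; length)
open import Data.Nat.ListAction using (sum)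
open import Data.List.Relation.Unary.All using (All)
open import Data.List.Relation.Unary.Linked using (Linked)
open import Data.Nat using (_≟_)

IsPartition : List ℕ → Set
IsPartition λs = Linked _≥_ λs × All (λ x → 0 < x) λs
  where open import Data.Product using (_×_)

-- part λ k = λ_k (1-indexed), 0 if λ has fewer than k parts.
part : List ℕ → ℕ → ℕ
part []        _             = 0
part (x ∷ xs)  zero          = 0
part (x ∷ xs)  (suc zero)    = x
part (x ∷ xs)  (suc (suc k)) = part xs (suc k)

-- boundedSeqs b λ : all weakly decreasing sequences (μ_1,…,μ_m), m = length λ,
-- with entries in ℕ (zeros allowed), μ_1 ≤ b, and μ_i ≤ λ_i for all i.
boundedSeqs : ℕ → List ℕ → List (List ℕ)
boundedSeqs b []       = [ [] ]
boundedSeqs b (l ∷ ls) =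
  concatMap (λ x → map (x ∷_) (boundedSeqs x ls)) (upTo (suc (b ⊓ l)))

-- subPartitions λ enumerates (each exactly once) the partitions μ ⊆ λ,
-- including the empty partition; μ is written padded with trailing zeros to
-- length (length λ) (any μ ⊆ λ has at most length λ nonzero parts).
subPartitions : List ℕ → List (List ℕ)
subPartitions []       = [ [] ]
subPartitions (l ∷ ls) =
  concatMap (λ x → map (x ∷_) (boundedSeqs x ls)) (upTo (suc l))

-- coeff λ n = a_n = number of partitions μ ⊆ λ with |μ| = n,
-- i.e. the coefficient of q^n in G_λ(q).
coeff : List ℕ → ℕ → ℕ
coeff λs n = length (filter (λ μ → sum μ ≟ n) (subPartitions λs))

-- Put M = λₖ.  Sub-partitions μ ⊆ λ with μ₁ ≤ M have their first k rows
-- inside a k × M box.  On integer functions of such μ we let E and F move one box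
-- out of / into these rows, with Proctor's weights, so that EF − FE = H is
-- diagonal (an sl₂-action, BoxAction).  A lowest-weight argument shows that a
-- function concentrated on size n with E u = 0 vanishes when 2n < kM; by linear
-- algebra (LinearRelations: more unknowns than equations) this yields the box
-- inequality a_n ≤ a_{n+1} for these μ (BoxInequality).  The remaining μ, with
-- μ₁ = x > M, are x followed by a smaller instance with k − 1 rows, shifted by x;
-- induction on k (Reduction) completes the proof.
module Submission where

open import Data.Nat using (ℕ; _≤_; _<_)
open import Data.List using (List; length)

-- For a list of naturals we use total, 0-indexed access: entries beyond the end
-- read as 0 (as for the parts of a partition).  Moving a box of a sequence
-- μ = (μ₀, μ₁, …) means adjusting a single entry by ±1.
module IndexedLists where

  open import Data.Nat using (zero; suc; pred; _+_; z≤n; s≤s)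
  open import Data.Nat.Properties using (+-suc; pred[n]≤n; ≤-refl)
  open import Data.List using ([]; _∷_)
  open import Data.Nat.ListAction using (sum)
  open import Relation.Binary.PropositionalEquality
  open import Relation.Nullary using (¬_)
  open import Data.Empty using (⊥-elim)

  get : List ℕ → ℕ → ℕ
  get []       _       = 0
  get (x ∷ xs) zero    = x
  get (x ∷ xs) (suc i) = get xs i

  adjust : (ℕ → ℕ) → ℕ → List ℕ → List ℕ
  adjust f _       []       = []
  adjust f zero    (x ∷ xs) = f x ∷ xs
  adjust f (suc i) (x ∷ xs) = x ∷ adjust f i xs

  length-adjust : ∀ f i xs → length (adjust f i xs) ≡ length xs
  length-adjust f i       []       = refl
  length-adjust f zero    (x ∷ xs) = refl
  length-adjust f (suc i) (x ∷ xs) = cong suc (length-adjust f i xs)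

  get-adjust-same : ∀ f i xs → i < length xs → get (adjust f i xs) i ≡ f (get xs i)
  get-adjust-same f zero    (x ∷ xs) _       = refl
  get-adjust-same f (suc i) (x ∷ xs) (s≤s p) = get-adjust-same f i xs p

  get-adjust-other : ∀ f i j xs → ¬ i ≡ j → get (adjust f i xs) j ≡ get xs j
  get-adjust-other f i       j       []       i≢j = refl
  get-adjust-other f zero    zero    (x ∷ xs) i≢j = ⊥-elim (i≢j refl)
  get-adjust-other f zero    (suc j) (x ∷ xs) i≢j = refl
  get-adjust-other f (suc i) zero    (x ∷ xs) i≢j = refl
  get-adjust-other f (suc i) (suc j) (x ∷ xs) i≢j =
    get-adjust-other f i j xs (λ i≡j → i≢j (cong suc i≡j))

  adjust-comm : ∀ f g i j xs → ¬ i ≡ j → adjust f i (adjust g j xs) ≡ adjust g j (adjust f i xs)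
  adjust-comm f g i       j       []       i≢j = refl
  adjust-comm f g zero    zero    (x ∷ xs) i≢j = ⊥-elim (i≢j refl)
  adjust-comm f g zero    (suc j) (x ∷ xs) i≢j = refl
  adjust-comm f g (suc i) zero    (x ∷ xs) i≢j = refl
  adjust-comm f g (suc i) (suc j) (x ∷ xs) i≢j =
    cong (x ∷_) (adjust-comm f g i j xs (λ i≡j → i≢j (cong suc i≡j)))

  adjust-suc-pred : ∀ i xs → 0 < get xs i → adjust suc i (adjust pred i xs) ≡ xs
  adjust-suc-pred zero    (suc x ∷ xs) _ = refl
  adjust-suc-pred (suc i) (x ∷ xs)     p = cong (x ∷_) (adjust-suc-pred i xs p)

  adjust-pred-suc : ∀ i xs → adjust pred i (adjust suc i xs) ≡ xs
  adjust-pred-suc i       []       = refl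
  adjust-pred-suc zero    (x ∷ xs) = refl
  adjust-pred-suc (suc i) (x ∷ xs) = cong (x ∷_) (adjust-pred-suc i xs)

  get-adjust-pred-≤ : ∀ r xs i → get (adjust pred r xs) i ≤ get xs i
  get-adjust-pred-≤ r       []       i       = z≤n
  get-adjust-pred-≤ zero    (x ∷ xs) zero    = pred[n]≤n {x}
  get-adjust-pred-≤ zero    (x ∷ xs) (suc i) = ≤-refl
  get-adjust-pred-≤ (suc r) (x ∷ xs) zero    = ≤-refl
  get-adjust-pred-≤ (suc r) (x ∷ xs) (suc i) = get-adjust-pred-≤ r xs i

  sum-adjust-suc : ∀ i xs → i < length xs → sum (adjust suc i xs) ≡ suc (sum xs)
  sum-adjust-suc zero    (x ∷ xs) _       = refl
  sum-adjust-suc (suc i) (x ∷ xs) (s≤s p) =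
    trans (cong (x +_) (sum-adjust-suc i xs p)) (+-suc x (sum xs))

  sum-adjust-pred : ∀ i xs → 0 < get xs i → suc (sum (adjust pred i xs)) ≡ sum xs
  sum-adjust-pred zero    (suc x ∷ xs) _ = refl
  sum-adjust-pred (suc i) (x ∷ xs)     p =
    trans (sym (+-suc x _)) (cong (x +_) (sum-adjust-pred i xs p))


module IntegerSums where

  open import Data.Nat using (zero; suc)
  import Data.Nat.Properties as ℕ
  open import Data.Integer using (ℤ; +_; _+_; _*_; _-_)
  import Data.Integer.Properties as ℤ
  open import Data.Integer.Tactic.RingSolver using (solve-∀)
  open import Relation.Binary.PropositionalEquality
  open import Relation.Nullary using (Dec; yes; no; ¬_)
  open import Data.Empty using (⊥-elim)
  open import Data.Sum using (inj₁; inj₂)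

  sumBelow : ℕ → (ℕ → ℤ) → ℤ
  sumBelow zero    f = + 0
  sumBelow (suc n) f = sumBelow n f + f n

  sumBelow-cong : ∀ n {f g : ℕ → ℤ} → (∀ i → i < n → f i ≡ g i) → sumBelow n f ≡ sumBelow n g
  sumBelow-cong zero    f≡g = refl
  sumBelow-cong (suc n) f≡g =
    cong₂ _+_ (sumBelow-cong n (λ i i<n → f≡g i (ℕ.m≤n⇒m≤1+n i<n))) (f≡g n ℕ.≤-refl)

  sumBelow-zero : ∀ n {f : ℕ → ℤ} → (∀ i → i < n → f i ≡ + 0) → sumBelow n f ≡ + 0
  sumBelow-zero n f≡0 = trans (sumBelow-cong n f≡0) (zeros n)
    where zeros : ∀ n → sumBelow n (λ _ → + 0) ≡ + 0
          zeros zero    = refl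
          zeros (suc n) = cong (_+ + 0) (zeros n)

  sumBelow-+ : ∀ n (f g : ℕ → ℤ) → sumBelow n (λ i → f i + g i) ≡ sumBelow n f + sumBelow n g
  sumBelow-+ zero    f g = refl
  sumBelow-+ (suc n) f g rewrite sumBelow-+ n f g = interchange (sumBelow n f) (sumBelow n g) (f n) (g n)
    where interchange : ∀ a b c d → (a + b) + (c + d) ≡ (a + c) + (b + d)
          interchange = solve-∀

  sumBelow-- : ∀ n (f g : ℕ → ℤ) → sumBelow n (λ i → f i - g i) ≡ sumBelow n f - sumBelow n g
  sumBelow-- zero    f g = refl
  sumBelow-- (suc n) f g rewrite sumBelow-- n f g = interchange (sumBelow n f) (sumBelow n g) (f n) (g n)
    where interchange : ∀ a b c d → (a - b) + (c - d) ≡ (a + c) - (b + d)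
          interchange = solve-∀

  sumBelow-*ˡ : ∀ n c (f : ℕ → ℤ) → sumBelow n (λ i → c * f i) ≡ c * sumBelow n f
  sumBelow-*ˡ zero    c f = sym (ℤ.*-zeroʳ c)
  sumBelow-*ˡ (suc n) c f rewrite sumBelow-*ˡ n c f = sym (ℤ.*-distribˡ-+ c (sumBelow n f) (f n))

  sumBelow-*ʳ : ∀ n (f : ℕ → ℤ) c → sumBelow n (λ i → f i * c) ≡ sumBelow n f * c
  sumBelow-*ʳ n f c = begin
    sumBelow n (λ i → f i * c) ≡⟨ sumBelow-cong n (λ i _ → ℤ.*-comm (f i) c) ⟩
    sumBelow n (λ i → c * f i) ≡⟨ sumBelow-*ˡ n c f ⟩
    c * sumBelow n f           ≡⟨ ℤ.*-comm c (sumBelow n f) ⟩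
    sumBelow n f * c           ∎
    where open ≡-Reasoning

  sumBelow-swap : ∀ n m (f : ℕ → ℕ → ℤ) →
    sumBelow n (λ i → sumBelow m (f i)) ≡ sumBelow m (λ j → sumBelow n (λ i → f i j))
  sumBelow-swap zero    m f = sym (sumBelow-zero m (λ _ _ → refl))
  sumBelow-swap (suc n) m f rewrite sumBelow-swap n m f =
    sym (sumBelow-+ m (λ j → sumBelow n (λ i → f i j)) (f n))

  sumBelow-suc : ∀ n (f : ℕ → ℤ) → sumBelow (suc n) f ≡ f 0 + sumBelow n (λ i → f (suc i))
  sumBelow-suc zero    f = ℤ.+-comm (+ 0) (f 0)
  sumBelow-suc (suc n) f rewrite sumBelow-suc n f = ℤ.+-assoc (f 0) _ _

  sumBelow-single : ∀ n r (f g : ℕ → ℤ) → r < n → (∀ s → s < n → ¬ s ≡ r → f s ≡ g s) →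
    sumBelow n f - sumBelow n g ≡ f r - g r
  sumBelow-single (suc n) r f g r<1+n f≡g with ℕ.m≤n⇒m<n∨m≡n r<1+n
  ... | inj₁ r<n rewrite f≡g n ℕ.≤-refl (λ n≡r → ℕ.<-irrefl (sym n≡r) (ℕ.≤-pred r<n)) =
    trans (cancel (sumBelow n f) (sumBelow n g) (g n))
          (sumBelow-single n r f g (ℕ.≤-pred r<n) (λ s s<n → f≡g s (ℕ.m≤n⇒m≤1+n s<n)))
    where cancel : ∀ a b c → (a + c) - (b + c) ≡ a - b
          cancel = solve-∀
  ... | inj₂ refl rewrite sumBelow-cong n {f} {g} (λ s s<n → f≡g s (ℕ.m≤n⇒m≤1+n s<n) (λ s≡n → ℕ.<-irrefl s≡n s<n)) =
    cancel (sumBelow n g) (f n) (g n)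
    where cancel : ∀ a b c → (a + b) - (a + c) ≡ b - c
          cancel = solve-∀

  telescope : ∀ n (g : ℕ → ℤ) → sumBelow n (λ i → g i - g (suc i)) ≡ g 0 - g n
  telescope zero    g = sym (ℤ.+-inverseʳ (g 0))
  telescope (suc n) g rewrite telescope n g = collapse (g 0) (g n) (g (suc n))
    where collapse : ∀ a b c → (a - b) + (b - c) ≡ a - c
          collapse = solve-∀

  sum-of-odds : ∀ n → sumBelow n (λ i → + 2 * + i + + 1) ≡ + n * + n
  sum-of-odds zero    = refl
  sum-of-odds (suc n) rewrite sum-of-odds n = square-step (+ n)
    where square-step : ∀ a → a * a + (+ 2 * a + + 1) ≡ (+ 1 + a) * (+ 1 + a)
          square-step = solve-∀

  indicator : {P : Set} → Dec P → ℤ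
  indicator (yes _) = + 1
  indicator (no _)  = + 0

  indicator-yes : {P : Set} (d : Dec P) → P → indicator d ≡ + 1
  indicator-yes (yes _) _ = refl
  indicator-yes (no ¬p) p = ⊥-elim (¬p p)

  indicator-⇔ : {P Q : Set} (p : Dec P) (q : Dec Q) → (P → Q) → (Q → P) → indicator p ≡ indicator q
  indicator-⇔ (yes _)  (yes _)  _ _ = refl
  indicator-⇔ (yes p)  (no ¬q)  f _ = ⊥-elim (¬q (f p))
  indicator-⇔ (no ¬p)  (yes q)  _ g = ⊥-elim (¬p (g q))
  indicator-⇔ (no _)   (no _)   _ _ = refl

  indicator-*-cong : {P : Set} (d : Dec P) {X Y : ℤ} → (P → X ≡ Y) → indicator d * X ≡ indicator d * Y
  indicator-*-cong (yes p) X≡Y = cong (+ 1 *_) (X≡Y p)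
  indicator-*-cong (no _)  X≡Y = refl

  indicator-*-zero : {P : Set} (d : Dec P) {X : ℤ} → (P → X ≡ + 0) → indicator d * X ≡ + 0
  indicator-*-zero d {X} X≡0 = trans (indicator-*-cong d X≡0) (ℤ.*-zeroʳ (indicator d))

open IndexedLists using (get)


-- Vectors are functions X → ℤ, so coordinates can
-- be arbitrary objects (later: partitions).  The proof is Gaussian elimination:
-- pick a coordinate c where the first vector v is nonzero, eliminate c from the
-- remaining vectors using v, and solve the smaller system by induction.
module LinearRelations {X : Set} where

  open import Data.Nat using (suc)
  import Data.Nat.Properties as ℕ
  open import Data.Integer using (ℤ; +_; -_; _+_; _*_; _-_)
  import Data.Integer.Properties as ℤ
  open import Data.Integer.Tactic.RingSolver using (solve-∀)
  open import Data.List using ([]; _∷_; map)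
  open import Data.List.Properties using (length-map)
  open import Data.List.Relation.Unary.Any using (Any; here; there)
  open import Data.List.Membership.Propositional using (_∈_)
  open import Data.Product using (Σ; _,_; _×_)
  open import Data.Sum using (_⊎_; inj₁; inj₂; [_,_]′)
  import Data.Sum as Sum
  open import Relation.Binary.PropositionalEquality
  open import Relation.Nullary using (yes; no; ¬_)

  Vector : Set
  Vector = X → ℤ

  combination : List ℤ → List Vector → X → ℤ
  combination (a ∷ α) (v ∷ vs) x = a * v x + combination α vs x
  combination _       _        x = + 0

  Nontrivial : List ℤ → Set
  Nontrivial = Any (λ a → ¬ a ≡ + 0)

  nontrivial-scale : ∀ c α → ¬ c ≡ + 0 → Nontrivial α → Nontrivial (map (c *_) α)
  nontrivial-scale c (a ∷ α) c≢0 (here a≢0)  = here λ ca≡0 → [ c≢0 , a≢0 ]′ (ℤ.i*j≡0⇒i≡0∨j≡0 c ca≡0)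
  nontrivial-scale c (a ∷ α) c≢0 (there α≢0) = there (nontrivial-scale c α c≢0 α≢0)

  combination-scale : ∀ c α vs x → combination (map (c *_) α) vs x ≡ c * combination α vs x
  combination-scale c []      vs       x = sym (ℤ.*-zeroʳ c)
  combination-scale c (a ∷ α) []       x = sym (ℤ.*-zeroʳ c)
  combination-scale c (a ∷ α) (v ∷ vs) x rewrite combination-scale c α vs x =
    distrib c a (v x) (combination α vs x)
    where distrib : ∀ c a y z → c * a * y + c * z ≡ c * (a * y + z)
          distrib = solve-∀

  combination-zeros : ∀ vs x → combination (map (λ _ → + 0) vs) vs x ≡ + 0
  combination-zeros []       x = refl
  combination-zeros (v ∷ vs) x rewrite combination-zeros vs x = refl

  eliminate : Vector → X → Vector → Vector
  eliminate v c w x = v c * w x - w c * v x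

  combination-eliminate : ∀ v c α ws x →
    combination α (map (eliminate v c) ws) x ≡ v c * combination α ws x - combination α ws c * v x
  combination-eliminate v c []      ws       x = vanish (v c) (v x)
    where vanish : ∀ a b → + 0 ≡ a * + 0 - + 0 * b
          vanish = solve-∀
  combination-eliminate v c (a ∷ α) []       x = vanish (v c) (v x)
    where vanish : ∀ a b → + 0 ≡ a * + 0 - + 0 * b
          vanish = solve-∀
  combination-eliminate v c (a ∷ α) (w ∷ ws) x rewrite combination-eliminate v c α ws x =
    expand a (v c) (v x) (w x) (w c) (combination α ws x) (combination α ws c)
    where expand : ∀ a vc vx wx wc L Lc →
            a * (vc * wx - wc * vx) + (vc * L - Lc * vx) ≡ vc * (a * wx + L) - (a * wc + Lc) * vx
          expand = solve-∀

  data Pivot (v : Vector) (cs : List X) : Set where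
    vanishes : (∀ {x} → x ∈ cs → v x ≡ + 0) → Pivot v cs
    pivot    : (c : X) (rest : List X) → ¬ v c ≡ + 0 → length cs ≡ suc (length rest) →
               (∀ {x} → x ∈ cs → x ≡ c ⊎ x ∈ rest) → Pivot v cs

  find-pivot : ∀ v cs → Pivot v cs
  find-pivot v []       = vanishes (λ ())
  find-pivot v (c ∷ cs) with v c ℤ.≟ + 0
  ... | no vc≢0 = pivot c cs vc≢0 refl λ { (here x≡c) → inj₁ x≡c ; (there x∈cs) → inj₂ x∈cs }
  ... | yes vc≡0 with find-pivot v cs
  ...   | vanishes v≡0 = vanishes λ { (here refl) → vc≡0 ; (there x∈cs) → v≡0 x∈cs }
  ...   | pivot c′ rest vc′≢0 len covers = pivot c′ (c ∷ rest) vc′≢0 (cong suc len)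
          λ { (here x≡c) → inj₂ (here x≡c) ; (there x∈cs) → Sum.map₂ there (covers x∈cs) }

  Relation : List Vector → List X → Set
  Relation vs cs = Σ (List ℤ) λ α →
    length α ≡ length vs × Nontrivial α × (∀ {x} → x ∈ cs → combination α vs x ≡ + 0)

  -- Gaussian elimination, by recursion on the number n of vectors (the recursive
  -- call is on new, reduced vectors).
  relation-by-elimination : ∀ n (vs : List Vector) (cs : List X) → length vs ≡ n → length cs < n → Relation vs cs
  relation-by-elimination (suc n) (v ∷ vs) cs len-vs cs<n with find-pivot v cs
  ... | vanishes v≡0 =
    (+ 1 ∷ map (λ _ → + 0) vs) , cong suc (length-map _ vs) , here (λ ()) ,
    λ {x} x∈cs → cong₂ (λ a b → + 1 * a + b) (v≡0 x∈cs) (combination-zeros vs x)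
  ... | pivot c rest vc≢0 len covers =
    extend (relation-by-elimination n (map (eliminate v c) vs) rest (trans (length-map _ vs) (ℕ.suc-injective len-vs))
                                    (ℕ.≤-pred (subst (_< suc n) len cs<n)))
    where
      -- A relation β among the reduced vectors gives the relation
      -- α = (-L, (v c) β) among v ∷ vs, where L = Σ βᵢ vsᵢ(c).
      extend : Relation (map (eliminate v c) vs) rest → Relation (v ∷ vs) cs
      extend (β , lenβ , β≢0 , β-solves) = α , lenα , there (nontrivial-scale (v c) β vc≢0 β≢0) , α-solves
        where
          L = combination β vs c
          α = (- L) ∷ map (v c *_) β

          lenα : length α ≡ suc (length vs)
          lenα = cong suc (trans (length-map _ β) (trans lenβ (length-map _ vs)))

          reduce : ∀ x → combination α (v ∷ vs) x ≡ combination β (map (eliminate v c) vs) x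
          reduce x = begin
            - L * v x + combination (map (v c *_) β) vs x ≡⟨ cong (λ z → - L * v x + z) (combination-scale (v c) β vs x) ⟩
            - L * v x + v c * combination β vs x         ≡⟨ swap L (v x) (v c * combination β vs x) ⟩
            v c * combination β vs x - L * v x           ≡⟨ sym (combination-eliminate v c β vs x) ⟩
            combination β (map (eliminate v c) vs) x     ∎
            where open ≡-Reasoning
                  swap : ∀ l y z → - l * y + z ≡ z - l * y
                  swap = solve-∀

          α-solves : ∀ {x} → x ∈ cs → combination α (v ∷ vs) x ≡ + 0
          α-solves {x} x∈cs with covers x∈cs
          ... | inj₁ refl = trans (reduce c) (trans (combination-eliminate v c β vs c) (cancel (v c) L))
            where cancel : ∀ a l → a * l - l * a ≡ + 0
                  cancel = solve-∀
          ... | inj₂ x∈rest = trans (reduce x) (β-solves x∈rest)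

  nontrivial-relation : ∀ (vs : List Vector) (cs : List X) → length cs < length vs → Relation vs cs
  nontrivial-relation vs cs = relation-by-elimination (length vs) vs cs refl


module BoundedSequences where

  open import Data.Nat using (zero; suc; _⊓_; z≤n; s≤s)
  import Data.Nat.Properties as ℕ
  open import Data.List using ([]; _∷_; map; concatMap; upTo)
  open import Data.List.Relation.Unary.Any using (here)
  open import Data.List.Relation.Unary.All using (lookup)
  import Data.List.Relation.Unary.All as All
  open import Data.List.Relation.Unary.Unique.Propositional using (Unique; []; _∷_)
  import Data.List.Relation.Unary.Unique.Propositional.Properties as Unique
  open import Data.List.Membership.Propositional using (_∈_; find; lose)
  open import Data.List.Membership.Propositional.Properties
    using (∈-concatMap⁺; ∈-concatMap⁻; ∈-map⁺; ∈-map⁻; ∈-upTo⁺; ∈-upTo⁻)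
  open import Data.Product using (Σ; _,_; _×_)
  open import Relation.Binary.PropositionalEquality
  open import Relation.Nullary using (¬_)
  open import Defs using (boundedSeqs)

  record Bounded (b : ℕ) (ls μ : List ℕ) : Set where
    field
      same-length : length μ ≡ length ls
      decreasing  : ∀ i → get μ (suc i) ≤ get μ i
      head-≤      : get μ 0 ≤ b
      below       : ∀ i → get μ i ≤ get ls i
  open Bounded public

  prepend : (ℕ → List (List ℕ)) → List ℕ → List (List ℕ)
  prepend S xs = concatMap (λ x → map (x ∷_) (S x)) xs

  ∈-prepend⁻ : ∀ S xs {μ} → μ ∈ prepend S xs →
    Σ ℕ λ x → Σ (List ℕ) λ μ′ → x ∈ xs × μ′ ∈ S x × μ ≡ x ∷ μ′
  ∈-prepend⁻ S xs μ∈ with find (∈-concatMap⁻ (λ x → map (x ∷_) (S x)) {xs = xs} μ∈)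
  ... | x , x∈xs , μ∈map with ∈-map⁻ (x ∷_) μ∈map
  ...   | μ′ , μ′∈S , μ≡ = x , μ′ , x∈xs , μ′∈S , μ≡

  ∈-prepend⁺ : ∀ S xs {x μ′} → x ∈ xs → μ′ ∈ S x → (x ∷ μ′) ∈ prepend S xs
  ∈-prepend⁺ S xs x∈xs μ′∈S = ∈-concatMap⁺ (λ x → map (x ∷_) (S x)) (lose x∈xs (∈-map⁺ (_ ∷_) μ′∈S))

  unique-prepend : ∀ S xs → Unique xs → (∀ x → Unique (S x)) → Unique (prepend S xs)
  unique-prepend S []       _               _        = []
  unique-prepend S (x ∷ xs) (x∉xs ∷ xs-uniq) S-uniq =
    Unique.++⁺ (Unique.map⁺ ∷-injectiveʳ (S-uniq x)) (unique-prepend S xs xs-uniq S-uniq) disjoint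
    where
      ∷-injectiveʳ : ∀ {μ ν : List ℕ} → x ∷ μ ≡ x ∷ ν → μ ≡ ν
      ∷-injectiveʳ refl = refl
      -- sequences in the two blocks differ in their first entry
      disjoint : ∀ {ν} → ¬ (ν ∈ map (x ∷_) (S x) × ν ∈ prepend S xs)
      disjoint (ν∈first , ν∈rest) with ∈-map⁻ (x ∷_) ν∈first | ∈-prepend⁻ S xs ν∈rest
      ... | _ , _ , refl | y , _ , y∈xs , _ , refl = lookup x∉xs y∈xs refl

  cons-bounded : ∀ {b l ls x μ} → x ≤ b → x ≤ l → Bounded x ls μ → Bounded b (l ∷ ls) (x ∷ μ)
  cons-bounded x≤b x≤l μ-bd = record
    { same-length = cong suc (same-length μ-bd)
    ; decreasing  = λ { zero → head-≤ μ-bd ; (suc i) → decreasing μ-bd i }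
    ; head-≤      = x≤b
    ; below       = λ { zero → x≤l ; (suc i) → below μ-bd i } }

  tail-bounded : ∀ {b l ls x μ} → Bounded b (l ∷ ls) (x ∷ μ) → Bounded x ls μ
  tail-bounded xμ-bd = record
    { same-length = ℕ.suc-injective (same-length xμ-bd)
    ; decreasing  = λ i → decreasing xμ-bd (suc i)
    ; head-≤      = decreasing xμ-bd 0
    ; below       = λ i → below xμ-bd (suc i) }

  ∈⇒bounded : ∀ b ls {μ} → μ ∈ boundedSeqs b ls → Bounded b ls μ
  ∈⇒bounded b [] (here refl) = record
    { same-length = refl ; decreasing = λ _ → z≤n ; head-≤ = z≤n ; below = λ _ → z≤n }
  ∈⇒bounded b (l ∷ ls) μ∈ with ∈-prepend⁻ (λ x → boundedSeqs x ls) (upTo (suc (b ⊓ l))) μ∈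
  ... | x , μ′ , x∈ , μ′∈ , refl =
    cons-bounded (ℕ.≤-trans x≤b⊓l (ℕ.m⊓n≤m b l)) (ℕ.≤-trans x≤b⊓l (ℕ.m⊓n≤n b l)) (∈⇒bounded x ls μ′∈)
    where x≤b⊓l = ℕ.≤-pred (∈-upTo⁻ x∈)

  bounded⇒∈ : ∀ b ls {μ} → Bounded b ls μ → μ ∈ boundedSeqs b ls
  bounded⇒∈ b []       {[]}    _    = here refl
  bounded⇒∈ b (l ∷ ls) {x ∷ μ} x∷μ-bd =
    ∈-prepend⁺ (λ x → boundedSeqs x ls) (upTo (suc (b ⊓ l)))
      (∈-upTo⁺ (s≤s (ℕ.⊓-glb (head-≤ x∷μ-bd) (below x∷μ-bd 0))))
      (bounded⇒∈ x ls (tail-bounded x∷μ-bd))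
  bounded⇒∈ b []       {_ ∷ _} μ-bd with () ← same-length μ-bd
  bounded⇒∈ b (_ ∷ _)  {[]}    μ-bd with () ← same-length μ-bd

  unique-boundedSeqs : ∀ b ls → Unique (boundedSeqs b ls)
  unique-boundedSeqs b []       = All.[] ∷ []
  unique-boundedSeqs b (l ∷ ls) =
    unique-prepend (λ x → boundedSeqs x ls) (upTo (suc (b ⊓ l))) (Unique.upTo⁺ _) (λ x → unique-boundedSeqs x ls)


-- Their first k rows can move freely
-- inside the k × M box, above the fixed row μₖ = t.  On functions
-- u : List ℕ → ℤ define
--   (E u)(μ) = Σ_{r<k} [row r of μ is removable] u(μ − box in row r)
--   (F u)(μ) = Σ_{r<k} [row r of μ is addable]   w_t(r, μ_r) u(μ + box in row r)
-- with the weights w_t(r, a) = (k − r + a − t)(M + r − a) (as in Proctor's proof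
-- of the unimodality of Gaussian coefficients).
-- The key identity is  E F − F E = H  with the diagonal operator
-- H(μ) = 2(μ₀ + ⋯ + μ_{k−1}) − k t − k M.  From it we derive the lowest-weight
-- lemma: a function concentrated on size n with E u = 0 vanishes if 2n < kM.
module BoxAction (M k : ℕ) (ls : List ℕ) (k≤len : k ≤ length ls) (wide : ∀ i → i < k → M ≤ get ls i) where

  open import Data.Nat using (zero; suc; pred; z≤n; s≤s; _∸_; _<?_) renaming (_+_ to _+ℕ_; _*_ to _*ℕ_)
  import Data.Nat.Properties as ℕ
  open import Data.Integer using (ℤ; +_; -_; _+_; _*_; _-_)
  import Data.Integer.Properties as ℤ
  open import Data.Integer.Tactic.RingSolver using (solve-∀)
  open import Data.List using ([]; _∷_)
  open import Data.Nat.ListAction using (sum)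
  open import Data.Product using (Σ; _,_)
  open import Data.Sum using (inj₁; inj₂)
  open import Data.Empty using (⊥-elim)
  open import Relation.Binary.PropositionalEquality
  open import Relation.Nullary using (Dec; yes; no; ¬_)
  open IndexedLists
  open IntegerSums
  open BoundedSequences

  Valid : List ℕ → Set
  Valid = Bounded M ls

  -- Rows 0, …, k−1 are the movable ones; row k (of length t) is the floor.
  floor : List ℕ → ℕ
  floor μ = get μ k

  cap : List ℕ → ℕ → ℕ
  cap μ zero    = M
  cap μ (suc r) = get μ r

  descent? : ∀ i μ → Dec (cap μ (suc i) < cap μ i)
  descent? i μ = cap μ (suc i) <? cap μ i

  addable? : ∀ r μ → Dec (get μ r < cap μ r)
  addable? r μ = descent? r μ

  removable? : ∀ r μ → Dec (get μ (suc r) < get μ r)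
  removable? r μ = descent? (suc r) μ

  add remove : ℕ → List ℕ → List ℕ
  add    = adjust suc
  remove = adjust pred

  weight : ℕ → ℕ → ℕ → ℤ
  weight t r a = (+ k - + r + + a - + t) * (+ M + + r - + a)

  E F : (List ℕ → ℤ) → List ℕ → ℤ
  E u μ = sumBelow k (λ r → indicator (removable? r μ) * u (remove r μ))
  F u μ = sumBelow k (λ s → indicator (addable? s μ) * (weight (floor μ) s (get μ s) * u (add s μ)))

  topSize : List ℕ → ℤ
  topSize μ = sumBelow k (λ r → + get μ r)

  H : List ℕ → ℤ
  H μ = + 2 * topSize μ - + k * + floor μ - + k * + M

  get-≤-cap : ∀ {μ} → Valid μ → ∀ r → get μ r ≤ cap μ r
  get-≤-cap μ-ok zero    = head-≤ μ-ok
  get-≤-cap μ-ok (suc r) = decreasing μ-ok r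

  movable-row : ∀ {μ} → Valid μ → ∀ r → r < k → r < length μ
  movable-row μ-ok r r<k rewrite same-length μ-ok = ℕ.<-≤-trans r<k k≤len

  cap-adjust-same : ∀ f r μ → cap (adjust f r μ) r ≡ cap μ r
  cap-adjust-same f zero    μ = refl
  cap-adjust-same f (suc r) μ = get-adjust-other f (suc r) r μ ℕ.1+n≢n

  cap-adjust-other : ∀ f r s μ → ¬ s ≡ suc r → cap (adjust f r μ) s ≡ cap μ s
  cap-adjust-other f r zero    μ _      = refl
  cap-adjust-other f r (suc s) μ s≢1+r = get-adjust-other f r s μ (λ r≡s → s≢1+r (cong suc (sym r≡s)))

  floor-adjust : ∀ f r μ → r < k → floor (adjust f r μ) ≡ floor μ
  floor-adjust f r μ r<k = get-adjust-other f r k μ (λ r≡k → ℕ.<-irrefl r≡k r<k)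

  indicator-<-cong : ∀ {a b c d} (p : Dec (a < b)) (q : Dec (c < d)) → a ≡ c → b ≡ d → indicator p ≡ indicator q
  indicator-<-cong p q refl refl = indicator-⇔ p q (λ x → x) (λ x → x)

  weight-shift : ∀ t r a → weight t r a ≡ weight t (suc r) (suc a)
  weight-shift t r a = shift (+ k) (+ M) (+ t) (+ r) (+ a)
    where shift : ∀ K M′ T R A → (K - R + A - T) * (M′ + R - A) ≡ (K - (+ 1 + R) + (+ 1 + A) - T) * (M′ + (+ 1 + R) - (+ 1 + A))
          shift = solve-∀

  weight-top : ∀ t → weight t 0 M ≡ + 0
  weight-top t = vanish (+ k) (+ M) (+ t)
    where vanish : ∀ K M′ T → (K - + 0 + M′ - T) * (M′ + + 0 - M′) ≡ + 0
          vanish = solve-∀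

  weight-floor : ∀ t → weight t k t ≡ + 0
  weight-floor t = vanish (+ k) (+ M) (+ t)
    where vanish : ∀ K M′ T → (K - K + T - T) * (M′ + K - T) ≡ + 0
          vanish = solve-∀

  -- A quadratic potential whose differences telescope the weight differences.
  potential : ℕ → ℕ → ℕ → ℤ
  potential t i a = (+ a - + i) * (+ a - + i) - (+ M - + k + + t) * + a

  weight-difference : ∀ t i a b →
    weight t i b - weight t i a ≡ (potential t i a - potential t (suc i) b) + (+ 2 * + i + + 1) - + 2 * + b
  weight-difference t i a b = expand (+ k) (+ M) (+ t) (+ i) (+ a) (+ b)
    where expand : ∀ K M′ T I A B →
            (K - I + B - T) * (M′ + I - B) - (K - I + A - T) * (M′ + I - A)
              ≡ (((A - I) * (A - I) - (M′ - K + T) * A) - ((B - (+ 1 + I)) * (B - (+ 1 + I)) - (M′ - K + T) * B))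
                + (+ 2 * I + + 1) - + 2 * B
          expand = solve-∀

  -- Writing ρ = cap μ (so ρ₀ = M, ρ_{i+1} = μ_i), both the removal and the
  -- addition weights are read off the descents of ρ; their difference then
  -- telescopes via weight-difference.
  module DiagonalSum {μ} (μ-ok : Valid μ) where

    t : ℕ
    t = floor μ

    -- The weight at a descent i of ρ, taken at its upper end ρ_i resp. lower end ρ_{i+1}.
    -- Note that lower r is literally the addition coefficient of row r.
    upper lower : ℕ → ℤ
    upper i = indicator (descent? i μ) * weight t i (cap μ i)
    lower i = indicator (descent? i μ) * weight t i (cap μ (suc i))

    removal-weight : ∀ r → indicator (removable? r μ) * weight t r (pred (get μ r)) ≡ upper (suc r)
    removal-weight r = indicator-*-cong (removable? r μ) (λ μ₊<μ → shifted (get μ r) (ℕ.≤-<-trans z≤n μ₊<μ))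
      where shifted : ∀ y → 0 < y → weight t r (pred y) ≡ weight t (suc r) y
            shifted (suc y) _ = weight-shift t r y

    -- Without a descent both ends coincide, so the difference is 0 either way.
    step-difference : ∀ i → lower i - upper i ≡ weight t i (cap μ (suc i)) - weight t i (cap μ i)
    step-difference i with descent? i μ
    ... | yes _ = unit (weight t i (cap μ (suc i))) (weight t i (cap μ i))
      where unit : ∀ a b → + 1 * a - + 1 * b ≡ a - b
            unit = solve-∀
    ... | no ¬descent rewrite ℕ.≤-antisym (get-≤-cap μ-ok i) (ℕ.≮⇒≥ ¬descent) =
      sym (ℤ.+-inverseʳ (weight t i (cap μ i)))

    upper-sum : sumBelow k (λ i → upper (suc i)) ≡ sumBelow (suc k) upper
    upper-sum = sym (begin
      sumBelow (suc k) upper                       ≡⟨ sumBelow-suc k upper ⟩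
      upper 0 + sumBelow k (λ i → upper (suc i))   ≡⟨ cong (_+ sumBelow k (λ i → upper (suc i))) upper-0 ⟩
      + 0 + sumBelow k (λ i → upper (suc i))       ≡⟨ ℤ.+-identityˡ _ ⟩
      sumBelow k (λ i → upper (suc i))             ∎)
      where open ≡-Reasoning
            upper-0 : upper 0 ≡ + 0
            upper-0 = trans (cong (indicator (descent? 0 μ) *_) (weight-top t)) (ℤ.*-zeroʳ (indicator (descent? 0 μ)))

    lower-sum : sumBelow k lower ≡ sumBelow (suc k) lower
    lower-sum = sym (trans (cong (λ z → sumBelow k lower + z) lower-k) (ℤ.+-identityʳ _))
      where lower-k : lower k ≡ + 0
            lower-k = trans (cong (indicator (descent? k μ) *_) (weight-floor t)) (ℤ.*-zeroʳ (indicator (descent? k μ)))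

    sum-step-differences :
      sumBelow (suc k) (λ i → lower i - upper i)
        ≡ (potential t 0 M - potential t (suc k) t) + + suc k * + suc k - + 2 * (topSize μ + + t)
    sum-step-differences = begin
      sumBelow (suc k) (λ i → lower i - upper i)
        ≡⟨ sumBelow-cong (suc k) (λ i _ → trans (step-difference i) (weight-difference t i (cap μ i) (cap μ (suc i)))) ⟩
      sumBelow (suc k) (λ i → (P i - P (suc i)) + (+ 2 * + i + + 1) - + 2 * + get μ i)
        ≡⟨ sumBelow-- (suc k) (λ i → (P i - P (suc i)) + (+ 2 * + i + + 1)) (λ i → + 2 * + get μ i) ⟩
      sumBelow (suc k) (λ i → (P i - P (suc i)) + (+ 2 * + i + + 1)) - sumBelow (suc k) (λ i → + 2 * + get μ i)
        ≡⟨ cong₂ _-_ (sumBelow-+ (suc k) (λ i → P i - P (suc i)) (λ i → + 2 * + i + + 1))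
                     (sumBelow-*ˡ (suc k) (+ 2) (λ i → + get μ i)) ⟩
      (sumBelow (suc k) (λ i → P i - P (suc i)) + sumBelow (suc k) (λ i → + 2 * + i + + 1)) - + 2 * (topSize μ + + t)
        ≡⟨ cong (λ z → z - + 2 * (topSize μ + + t)) (cong₂ _+_ (telescope (suc k) P) (sum-of-odds (suc k))) ⟩
      (potential t 0 M - potential t (suc k) t) + + suc k * + suc k - + 2 * (topSize μ + + t) ∎
      where open ≡-Reasoning
            P : ℕ → ℤ
            P i = potential t i (cap μ i)

    diagonal-sum : sumBelow k (λ r → indicator (removable? r μ) * weight t r (pred (get μ r)) - lower r) ≡ H μ
    diagonal-sum = begin
      sumBelow k (λ r → indicator (removable? r μ) * weight t r (pred (get μ r)) - lower r)
        ≡⟨ sumBelow-cong k (λ r _ → cong (_- lower r) (removal-weight r)) ⟩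
      sumBelow k (λ r → upper (suc r) - lower r)
        ≡⟨ sumBelow-- k (λ r → upper (suc r)) lower ⟩
      sumBelow k (λ r → upper (suc r)) - sumBelow k lower
        ≡⟨ cong₂ _-_ upper-sum lower-sum ⟩
      sumBelow (suc k) upper - sumBelow (suc k) lower
        ≡⟨ negate (sumBelow (suc k) upper) (sumBelow (suc k) lower) ⟩
      - (sumBelow (suc k) lower - sumBelow (suc k) upper)
        ≡⟨ cong -_ (trans (sym (sumBelow-- (suc k) lower upper)) sum-step-differences) ⟩
      - ((potential t 0 M - potential t (suc k) t) + + suc k * + suc k - + 2 * (topSize μ + + t))
        ≡⟨ simplify (+ k) (+ M) (+ t) (topSize μ) ⟩
      H μ ∎
      where open ≡-Reasoning
            negate : ∀ a b → a - b ≡ - (b - a)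
            negate = solve-∀
            simplify : ∀ K M′ T S →
              - ((((M′ - + 0) * (M′ - + 0) - (M′ - K + T) * M′) - ((T - (+ 1 + K)) * (T - (+ 1 + K)) - (M′ - K + T) * T))
                  + ((+ 1 + K) * (+ 1 + K)) - + 2 * (S + T))
              ≡ + 2 * S - K * T - K * M′
            simplify = solve-∀

  -- Expanding both sides as double sums over rows (r, s), the
  -- terms with r ≠ s agree, because moves in different rows commute and do not
  -- affect each other's feasibility or weight; what remains is the diagonal sum.
  module Commutator (u : List ℕ → ℤ) {μ} (μ-ok : Valid μ) where

    open DiagonalSum μ-ok using (lower; diagonal-sum)

    remove-add : ℕ → ℕ → ℤ
    remove-add r s = indicator (removable? r μ) *
      (indicator (addable? s (remove r μ)) * (weight (floor (remove r μ)) s (get (remove r μ) s) * u (add s (remove r μ))))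

    add-remove : ℕ → ℕ → ℤ
    add-remove s r = indicator (addable? s μ) *
      (weight (floor μ) s (get μ s) * (indicator (removable? r (add s μ)) * u (remove r (add s μ))))

    EF-expand : E (F u) μ ≡ sumBelow k (λ r → sumBelow k (remove-add r))
    EF-expand = sumBelow-cong k (λ r _ → sym (sumBelow-*ˡ k (indicator (removable? r μ)) _))

    FE-expand : F (E u) μ ≡ sumBelow k (λ r → sumBelow k (λ s → add-remove s r))
    FE-expand = trans (sumBelow-cong k (λ s _ → pull-out s)) (sumBelow-swap k k add-remove)
      where
        pull-out : ∀ s → indicator (addable? s μ) * (weight (floor μ) s (get μ s) * E u (add s μ))
                           ≡ sumBelow k (add-remove s)
        pull-out s = begin
          indicator (addable? s μ) * (weight (floor μ) s (get μ s) * E u (add s μ))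
            ≡⟨ cong (indicator (addable? s μ) *_) (sym (sumBelow-*ˡ k (weight (floor μ) s (get μ s)) _)) ⟩
          indicator (addable? s μ) * sumBelow k (λ r → weight (floor μ) s (get μ s) *
                                                     (indicator (removable? r (add s μ)) * u (remove r (add s μ))))
            ≡⟨ sym (sumBelow-*ˡ k (indicator (addable? s μ)) _) ⟩
          sumBelow k (add-remove s) ∎
          where open ≡-Reasoning

    feasibility-commutes : ∀ r s → r < k → s < k → ¬ r ≡ s →
      indicator (removable? r μ) * indicator (addable? s (remove r μ))
        ≡ indicator (addable? s μ) * indicator (removable? r (add s μ))
    feasibility-commutes r s r<k s<k r≢s with s ℕ.≟ suc r
    ... | yes refl = cong (indicator (removable? r μ) *_)
      (indicator-⇔ (addable? (suc r) (remove r μ)) (removable? r (add (suc r) μ))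
        (λ p → subst₂ _<_ (sym added-below) (sym added-above) (<-pred⇒suc-< (subst₂ _<_ removed-below removed-above p)))
        (λ p → subst₂ _<_ (sym removed-below) (sym removed-above) (suc-<⇒<-pred (subst₂ _<_ added-below added-above p))))
      where
        x = get μ (suc r)
        y = get μ r
        removed-below : get (remove r μ) (suc r) ≡ x
        removed-below = get-adjust-other pred r (suc r) μ (λ r≡1+r → ℕ.1+n≢n (sym r≡1+r))
        removed-above : cap (remove r μ) (suc r) ≡ pred y
        removed-above = get-adjust-same pred r μ (movable-row μ-ok r r<k)
        added-below : get (add (suc r) μ) (suc r) ≡ suc x
        added-below = get-adjust-same suc (suc r) μ (movable-row μ-ok (suc r) s<k)
        added-above : get (add (suc r) μ) r ≡ y
        added-above = get-adjust-other suc (suc r) r μ ℕ.1+n≢n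
        <-pred⇒suc-< : ∀ {a b} → a < pred b → suc a < b
        <-pred⇒suc-< {b = suc b} a<b = s≤s a<b
        suc-<⇒<-pred : ∀ {a b} → suc a < b → a < pred b
        suc-<⇒<-pred {b = suc b} (s≤s a<b) = a<b
    ... | no s≢1+r = trans (ℤ.*-comm (indicator (removable? r μ)) _)
      (cong₂ _*_
        (indicator-<-cong (addable? s (remove r μ)) (addable? s μ)
          (get-adjust-other pred r s μ r≢s) (cap-adjust-other pred r s μ s≢1+r))
        (indicator-<-cong (removable? r μ) (removable? r (add s μ))
          (sym (get-adjust-other suc s (suc r) μ s≢1+r)) (sym (get-adjust-other suc s r μ (λ s≡r → r≢s (sym s≡r))))))

    moves-commute : ∀ r s → r < k → s < k → ¬ r ≡ s → remove-add r s ≡ add-remove s r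
    moves-commute r s r<k s<k r≢s = begin
      remove-add r s
        ≡⟨ cong (λ z → indicator (removable? r μ) * (indicator (addable? s (remove r μ)) * z))
             (cong₂ _*_ (cong₂ (λ t a → weight t s a) (floor-adjust pred r μ r<k) (get-adjust-other pred r s μ r≢s))
                        (cong u (adjust-comm suc pred s r μ (λ s≡r → r≢s (sym s≡r))))) ⟩
      R * (A * (W * U))
        ≡⟨ regroup R A W U ⟩
      (R * A) * (W * U)
        ≡⟨ cong (_* (W * U)) (feasibility-commutes r s r<k s<k r≢s) ⟩
      (A′ * R′) * (W * U)
        ≡⟨ ungroup A′ R′ W U ⟩
      add-remove s r ∎
      where
        open ≡-Reasoning
        R  = indicator (removable? r μ)
        A  = indicator (addable? s (remove r μ))
        A′ = indicator (addable? s μ)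
        R′ = indicator (removable? r (add s μ))
        W  = weight (floor μ) s (get μ s)
        U  = u (remove r (add s μ))
        regroup : ∀ a b c d → a * (b * (c * d)) ≡ (a * b) * (c * d)
        regroup = solve-∀
        ungroup : ∀ a b c d → (a * b) * (c * d) ≡ a * (c * (b * d))
        ungroup = solve-∀

    remove-add-diagonal : ∀ r → r < k →
      remove-add r r ≡ indicator (removable? r μ) * (weight (floor μ) r (pred (get μ r)) * u μ)
    remove-add-diagonal r r<k = indicator-*-cong (removable? r μ) λ μ₊<μ →
      let row-nonempty = ℕ.≤-<-trans z≤n μ₊<μ
          removed      = get-adjust-same pred r μ (movable-row μ-ok r r<k)
          re-addable : get (remove r μ) r < cap (remove r μ) r
          re-addable = subst₂ _<_ (sym removed) (sym (cap-adjust-same pred r μ))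
                         (ℕ.<-≤-trans (pred-< (get μ r) row-nonempty) (get-≤-cap μ-ok r))
      in begin
        indicator (addable? r (remove r μ)) * (weight (floor (remove r μ)) r (get (remove r μ) r) * u (add r (remove r μ)))
          ≡⟨ cong (_* (weight (floor (remove r μ)) r (get (remove r μ) r) * u (add r (remove r μ))))
                  (indicator-yes (addable? r (remove r μ)) re-addable) ⟩
        + 1 * (weight (floor (remove r μ)) r (get (remove r μ) r) * u (add r (remove r μ)))
          ≡⟨ ℤ.*-identityˡ _ ⟩
        weight (floor (remove r μ)) r (get (remove r μ) r) * u (add r (remove r μ))
          ≡⟨ cong₂ _*_ (cong₂ (λ t a → weight t r a) (floor-adjust pred r μ r<k) removed)
                       (cong u (adjust-suc-pred r μ row-nonempty)) ⟩
        weight (floor μ) r (pred (get μ r)) * u μ ∎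
      where open ≡-Reasoning
            pred-< : ∀ y → 0 < y → pred y < y
            pred-< (suc y) _ = ℕ.≤-refl

    add-remove-diagonal : ∀ r → r < k →
      add-remove r r ≡ indicator (addable? r μ) * (weight (floor μ) r (get μ r) * u μ)
    add-remove-diagonal r r<k = cong (λ z → indicator (addable? r μ) * (weight (floor μ) r (get μ r) * z)) (begin
      indicator (removable? r (add r μ)) * u (remove r (add r μ))
        ≡⟨ cong (_* u (remove r (add r μ))) (indicator-yes (removable? r (add r μ)) re-removable) ⟩
      + 1 * u (remove r (add r μ))                                  ≡⟨ ℤ.*-identityˡ _ ⟩
      u (remove r (add r μ))                                        ≡⟨ cong u (adjust-pred-suc r μ) ⟩
      u μ ∎)
      where
        open ≡-Reasoning
        re-removable : get (add r μ) (suc r) < get (add r μ) r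
        re-removable = subst₂ _<_ (sym (get-adjust-other suc r (suc r) μ (λ r≡1+r → ℕ.1+n≢n (sym r≡1+r))))
                                  (sym (get-adjust-same suc r μ (movable-row μ-ok r r<k))) (s≤s (decreasing μ-ok r))

    commutator : E (F u) μ - F (E u) μ ≡ H μ * u μ
    commutator = begin
      E (F u) μ - F (E u) μ
        ≡⟨ cong₂ _-_ EF-expand FE-expand ⟩
      sumBelow k (λ r → sumBelow k (remove-add r)) - sumBelow k (λ r → sumBelow k (λ s → add-remove s r))
        ≡⟨ sym (sumBelow-- k _ _) ⟩
      sumBelow k (λ r → sumBelow k (remove-add r) - sumBelow k (λ s → add-remove s r))
        ≡⟨ sumBelow-cong k (λ r r<k → sumBelow-single k r (remove-add r) (λ s → add-remove s r) r<k
                                        (λ s s<k s≢r → moves-commute r s r<k s<k (λ r≡s → s≢r (sym r≡s)))) ⟩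
      sumBelow k (λ r → remove-add r r - add-remove r r)
        ≡⟨ sumBelow-cong k (λ r r<k → trans (cong₂ _-_ (remove-add-diagonal r r<k) (add-remove-diagonal r r<k))
                                             (factor (indicator (removable? r μ)) (weight (floor μ) r (pred (get μ r)))
                                                     (indicator (addable? r μ)) (weight (floor μ) r (get μ r)) (u μ))) ⟩
      sumBelow k (λ r → (indicator (removable? r μ) * weight (floor μ) r (pred (get μ r)) - lower r) * u μ)
        ≡⟨ sumBelow-*ʳ k _ (u μ) ⟩
      sumBelow k (λ r → indicator (removable? r μ) * weight (floor μ) r (pred (get μ r)) - lower r) * u μ
        ≡⟨ cong (_* u μ) diagonal-sum ⟩
      H μ * u μ ∎
      where open ≡-Reasoning
            factor : ∀ a b c d x → a * (b * x) - c * (d * x) ≡ (a * b - c * d) * x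
            factor = solve-∀

  EF-FE : ∀ u {ν} → Valid ν → E (F u) ν ≡ F (E u) ν + H ν * u ν
  EF-FE u {ν} ν-ok = trans (sym (rearrange (E (F u) ν) (F (E u) ν))) (cong (λ z → F (E u) ν + z) (Commutator.commutator u ν-ok))
    where rearrange : ∀ a b → b + (a - b) ≡ a
          rearrange = solve-∀

  get-≤-M : ∀ {μ} → Valid μ → ∀ i → get μ i ≤ M
  get-≤-M μ-ok zero    = head-≤ μ-ok
  get-≤-M μ-ok (suc i) = ℕ.≤-trans (decreasing μ-ok i) (get-≤-M μ-ok i)

  remove-valid : ∀ {μ} r → Valid μ → r < k → get μ (suc r) < get μ r → Valid (remove r μ)
  remove-valid {μ} r μ-ok r<k removable = record
    { same-length = trans (length-adjust pred r μ) (same-length μ-ok)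
    ; decreasing  = still-decreasing
    ; head-≤      = ℕ.≤-trans (get-adjust-pred-≤ r μ 0) (head-≤ μ-ok)
    ; below       = λ i → ℕ.≤-trans (get-adjust-pred-≤ r μ i) (below μ-ok i) }
    where
      still-decreasing : ∀ i → get (remove r μ) (suc i) ≤ get (remove r μ) i
      still-decreasing i with i ℕ.≟ r
      ... | yes refl = subst₂ _≤_ (sym (get-adjust-other pred r (suc r) μ (λ r≡1+r → ℕ.1+n≢n (sym r≡1+r))))
                                  (sym (get-adjust-same pred r μ (movable-row μ-ok r r<k))) (≤-pred-of-< removable)
        where ≤-pred-of-< : ∀ {a b} → a < b → a ≤ pred b
              ≤-pred-of-< {b = suc b} (s≤s a≤b) = a≤b
      ... | no i≢r = ℕ.≤-trans (get-adjust-pred-≤ r μ (suc i))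
                       (subst (get μ (suc i) ≤_) (sym (get-adjust-other pred r i μ (λ r≡i → i≢r (sym r≡i)))) (decreasing μ-ok i))

  add-valid : ∀ {μ} r → Valid μ → r < k → get μ r < cap μ r → Valid (add r μ)
  add-valid {μ} r μ-ok r<k addable = record
    { same-length = trans (length-adjust suc r μ) (same-length μ-ok)
    ; decreasing  = still-decreasing
    ; head-≤      = still-≤-M r r<k addable
    ; below       = still-below }
    where
      added : get (add r μ) r ≡ suc (get μ r)
      added = get-adjust-same suc r μ (movable-row μ-ok r r<k)
      cap-≤-M : ∀ r → cap μ r ≤ M
      cap-≤-M zero    = ℕ.≤-refl
      cap-≤-M (suc r) = get-≤-M μ-ok r
      still-≤-M : ∀ r → r < k → get μ r < cap μ r → get (add r μ) 0 ≤ M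
      still-≤-M zero     r<k addable = subst (_≤ M) (sym (get-adjust-same suc 0 μ (movable-row μ-ok 0 r<k))) addable
      still-≤-M (suc r′) _   _       = subst (_≤ M) (sym (get-adjust-other suc (suc r′) 0 μ (λ ()))) (head-≤ μ-ok)
      -- the grown row r < k stays below M ≤ λ_r
      still-below : ∀ i → get (add r μ) i ≤ get ls i
      still-below i with i ℕ.≟ r
      ... | yes refl = subst (_≤ get ls i) (sym added) (ℕ.≤-trans addable (ℕ.≤-trans (cap-≤-M i) (wide i r<k)))
      ... | no i≢r   = subst (_≤ get ls i) (sym (get-adjust-other suc r i μ (λ r≡i → i≢r (sym r≡i)))) (below μ-ok i)
      still-decreasing : ∀ i → get (add r μ) (suc i) ≤ get (add r μ) i
      still-decreasing i with i ℕ.≟ r | suc i ℕ.≟ r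
      ... | yes refl | _ = subst₂ _≤_ (sym (get-adjust-other suc r (suc r) μ (λ r≡1+r → ℕ.1+n≢n (sym r≡1+r)))) (sym added)
                                      (ℕ.m≤n⇒m≤1+n (decreasing μ-ok r))
      ... | no _    | yes refl = subst₂ _≤_ (sym added) (sym (get-adjust-other suc (suc i) i μ ℕ.1+n≢n)) addable
      ... | no i≢r  | no 1+i≢r =
        subst₂ _≤_ (sym (get-adjust-other suc r (suc i) μ (λ r≡1+i → 1+i≢r (sym r≡1+i))))
                   (sym (get-adjust-other suc r i μ (λ r≡i → i≢r (sym r≡i)))) (decreasing μ-ok i)

  Vanishes : (List ℕ → ℤ) → Set
  Vanishes w = ∀ μ → Valid μ → w μ ≡ + 0

  ConcentratedOn : ℤ → (List ℕ → ℤ) → Set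
  ConcentratedOn z w = ∀ μ → Valid μ → ¬ (+ sum μ ≡ z) → w μ ≡ + 0

  E-vanishes : ∀ w → Vanishes w → Vanishes (E w)
  E-vanishes w w≡0 μ μ-ok = sumBelow-zero k λ r r<k →
    indicator-*-zero (removable? r μ) (λ removable → w≡0 (remove r μ) (remove-valid r μ-ok r<k removable))

  F-vanishes : ∀ w → Vanishes w → Vanishes (F w)
  F-vanishes w w≡0 μ μ-ok = sumBelow-zero k λ s s<k →
    indicator-*-zero (addable? s μ) (λ addable →
      trans (cong (weight (floor μ) s (get μ s) *_) (w≡0 (add s μ) (add-valid s μ-ok s<k addable)))
            (ℤ.*-zeroʳ (weight (floor μ) s (get μ s))))

  E-concentrated : ∀ z w → ConcentratedOn z w → ConcentratedOn (z + + 1) (E w)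
  E-concentrated z w w-conc μ μ-ok size≢ = sumBelow-zero k λ r r<k →
    indicator-*-zero (removable? r μ) λ removable →
      w-conc (remove r μ) (remove-valid r μ-ok r<k removable) λ size≡z → size≢ (begin
        + sum μ                         ≡⟨ cong +_ (sym (sum-adjust-pred r μ (ℕ.≤-<-trans z≤n removable))) ⟩
        + suc (sum (remove r μ))        ≡⟨ cong +_ (ℕ.+-comm 1 _) ⟩
        + sum (remove r μ) + + 1        ≡⟨ cong (_+ + 1) size≡z ⟩
        z + + 1                         ∎)
    where open ≡-Reasoning

  F-concentrated : ∀ z w → ConcentratedOn z w → ConcentratedOn (z - + 1) (F w)
  F-concentrated z w w-conc μ μ-ok size≢ = sumBelow-zero k λ s s<k →
    indicator-*-zero (addable? s μ) λ addable →
      trans (cong (weight (floor μ) s (get μ s) *_)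
              (w-conc (add s μ) (add-valid s μ-ok s<k addable) (λ size≡z → size≢ (one-less s s<k size≡z))))
            (ℤ.*-zeroʳ (weight (floor μ) s (get μ s)))
    where
      open ≡-Reasoning
      one-less : ∀ s → s < k → + sum (add s μ) ≡ z → + sum μ ≡ z - + 1
      one-less s s<k size≡z = begin
        + sum μ                   ≡⟨ sym (cancel (+ sum μ)) ⟩
        (+ sum μ + + 1) - + 1     ≡⟨ cong (_- + 1) (cong +_ (ℕ.+-comm (sum μ) 1)) ⟩
        + suc (sum μ) - + 1       ≡⟨ cong (λ n → + n - + 1) (sym (sum-adjust-suc s μ (movable-row μ-ok s s<k))) ⟩
        + sum (add s μ) - + 1     ≡⟨ cong (_- + 1) size≡z ⟩
        z - + 1                   ∎
        where cancel : ∀ a → (a + + 1) - + 1 ≡ a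
              cancel = solve-∀

  F-scale : ∀ (a b c : List ℕ → ℤ) → (∀ μ r → Valid μ → r < k → c (add r μ) ≡ c μ) →
            (∀ ν → Valid ν → a ν ≡ c ν * b ν) → ∀ μ → Valid μ → F a μ ≡ c μ * F b μ
  F-scale a b c c-invariant a≡cb μ μ-ok =
    trans (sumBelow-cong k (λ s s<k → term s s<k (addable? s μ))) (sumBelow-*ˡ k (c μ) _)
    where
      term : ∀ s → s < k → (d : Dec (get μ s < cap μ s)) →
             indicator d * (weight (floor μ) s (get μ s) * a (add s μ))
               ≡ c μ * (indicator d * (weight (floor μ) s (get μ s) * b (add s μ)))
      term s s<k (yes addable) = trans
        (cong (λ z → + 1 * (weight (floor μ) s (get μ s) * z))
              (trans (a≡cb (add s μ) (add-valid s μ-ok s<k addable)) (cong (_* b (add s μ)) (c-invariant μ s μ-ok s<k))))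
        (commute (c μ) (weight (floor μ) s (get μ s)) (b (add s μ)))
        where commute : ∀ C W B → + 1 * (W * (C * B)) ≡ C * (+ 1 * (W * B))
              commute = solve-∀
      term s s<k (no _) = sym (ℤ.*-zeroʳ (c μ))

  topSize-add : ∀ {μ} r → Valid μ → r < k → topSize (add r μ) ≡ topSize μ + + 1
  topSize-add {μ} r μ-ok r<k = begin
    topSize (add r μ)                                 ≡⟨ sym (cancel (topSize (add r μ)) (topSize μ)) ⟩
    (topSize (add r μ) - topSize μ) + topSize μ       ≡⟨ cong (_+ topSize μ) one-row-differs ⟩
    (+ get (add r μ) r - + get μ r) + topSize μ       ≡⟨ cong (λ z → (+ z - + get μ r) + topSize μ) added ⟩
    (+ 1 + + get μ r - + get μ r) + topSize μ         ≡⟨ simplify (topSize μ) (+ get μ r) ⟩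
    topSize μ + + 1                                   ∎
    where
      open ≡-Reasoning
      added = get-adjust-same suc r μ (movable-row μ-ok r r<k)
      one-row-differs = sumBelow-single k r (λ i → + get (add r μ) i) (λ i → + get μ i) r<k
                          (λ s _ s≢r → cong +_ (get-adjust-other suc r s μ (λ r≡s → s≢r (sym r≡s))))
      cancel : ∀ a b → (a - b) + b ≡ a
      cancel = solve-∀
      simplify : ∀ b x → (+ 1 + x - x) + b ≡ b + + 1
      simplify = solve-∀

  offset : List ℕ → ℤ
  offset μ = H μ - + 2 * + sum μ

  offset-add : ∀ {μ} r → Valid μ → r < k → offset (add r μ) ≡ offset μ
  offset-add {μ} r μ-ok r<k = begin
    offset (add r μ)
      ≡⟨ cong₂ (λ T S → + 2 * T - + k * + floor (add r μ) - + k * + M - + 2 * S)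
              (topSize-add r μ-ok r<k)
              (trans (cong +_ (sum-adjust-suc r μ (movable-row μ-ok r r<k))) (cong +_ (ℕ.+-comm 1 (sum μ)))) ⟩
    + 2 * (topSize μ + + 1) - + k * + floor (add r μ) - + k * + M - + 2 * (+ sum μ + + 1)
      ≡⟨ cong (λ t → + 2 * (topSize μ + + 1) - + k * + t - + k * + M - + 2 * (+ sum μ + + 1)) (floor-adjust suc r μ r<k) ⟩
    + 2 * (topSize μ + + 1) - + k * + floor μ - + k * + M - + 2 * (+ sum μ + + 1)
      ≡⟨ cancel (topSize μ) (+ k) (+ floor μ) (+ M) (+ sum μ) ⟩
    offset μ ∎
    where open ≡-Reasoning
          cancel : ∀ T K t M′ S → + 2 * (T + + 1) - K * t - K * M′ - + 2 * (S + + 1) ≡ + 2 * T - K * t - K * M′ - + 2 * S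
          cancel = solve-∀

  size-split : ∀ n μ → Σ ℕ λ rest → + sum μ ≡ sumBelow n (λ r → + get μ r) + + rest
  size-split n       []       = 0 , sym (cong (_+ + 0) (sumBelow-zero n (λ _ _ → refl)))
  size-split zero    (x ∷ μ)  = sum (x ∷ μ) , sym (ℤ.+-identityˡ _)
  size-split (suc n) (x ∷ μ) with size-split n μ
  ... | rest , μ-split = rest , (begin
    + (x +ℕ sum μ)                                              ≡⟨ ℤ.pos-+ x (sum μ) ⟩
    + x + + sum μ                                               ≡⟨ cong (λ z → + x + z) μ-split ⟩
    + x + (sumBelow n (λ r → + get μ r) + + rest)
      ≡⟨ sym (ℤ.+-assoc (+ x) (sumBelow n (λ r → + get μ r)) (+ rest)) ⟩
    (+ x + sumBelow n (λ r → + get μ r)) + + rest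
      ≡⟨ cong (_+ + rest) (sym (sumBelow-suc n (λ r → + get (x ∷ μ) r))) ⟩
    sumBelow (suc n) (λ r → + get (x ∷ μ) r) + + rest           ∎)
    where open ≡-Reasoning

  -- offset μ = −e − kM for a natural number e (namely 2·(size below row k) + k·t).
  offset-≡ : ∀ μ → Σ ℕ λ e → offset μ ≡ - + e - + k * + M
  offset-≡ μ with size-split k μ
  ... | rest , μ-split = 2 *ℕ rest +ℕ k *ℕ floor μ , (begin
    offset μ
      ≡⟨ cong (λ S → H μ - + 2 * S) μ-split ⟩
    H μ - + 2 * (topSize μ + + rest)
      ≡⟨ expand (topSize μ) (+ rest) (+ k) (+ floor μ) (+ M) ⟩
    - (+ 2 * + rest + + k * + floor μ) - + k * + M
      ≡⟨ cong (λ e → - e - + k * + M) (sym e≡) ⟩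
    - + (2 *ℕ rest +ℕ k *ℕ floor μ) - + k * + M ∎)
    where
      open ≡-Reasoning
      expand : ∀ T R K t M′ → + 2 * T - K * t - K * M′ - + 2 * (T + R) ≡ - (+ 2 * R + K * t) - K * M′
      expand = solve-∀
      e≡ : + (2 *ℕ rest +ℕ k *ℕ floor μ) ≡ + 2 * + rest + + k * + floor μ
      e≡ = trans (ℤ.pos-+ (2 *ℕ rest) (k *ℕ floor μ)) (cong₂ _+_ (ℤ.pos-* 2 rest) (ℤ.pos-* k (floor μ)))

  -- The functions Fʲ v satisfy E F^{j+1} v = (j+1)(c − j)·Fʲ v with a
  -- negative "eigenvalue" c = offset + 2n, so the scalar never vanishes.  As
  -- F^{n+1} v is concentrated on size −1 it is 0, and descending gives v = 0.
  module LowestWeight (n : ℕ) (v : List ℕ → ℤ) (v-conc : ConcentratedOn (+ n) v)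
                      (Ev≡0 : Vanishes (E v)) (small : 2 *ℕ n < k *ℕ M) where

    Fpow : ℕ → List ℕ → ℤ
    Fpow zero    = v
    Fpow (suc j) = F (Fpow j)

    Fpow-concentrated : ∀ j → ConcentratedOn (+ n - + j) (Fpow j)
    Fpow-concentrated zero    μ μ-ok size≢ = v-conc μ μ-ok (λ size≡ → size≢ (trans size≡ (sym (ℤ.+-identityʳ (+ n)))))
    Fpow-concentrated (suc j) =
      subst (λ z → ConcentratedOn z (Fpow (suc j))) (regroup (+ n) (+ j)) (F-concentrated _ _ (Fpow-concentrated j))
      where regroup : ∀ a b → a - b - + 1 ≡ a - (+ 1 + b)
            regroup = solve-∀

    eigen : List ℕ → ℤ
    eigen ν = offset ν + + 2 * + n

    H-on-Fpow : ∀ j ν → Valid ν → H ν * Fpow j ν ≡ (eigen ν - + 2 * + j) * Fpow j ν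
    H-on-Fpow j ν ν-ok with + sum ν ℤ.≟ + n - + j
    ... | yes size≡ = cong (_* Fpow j ν) (begin
      H ν                              ≡⟨ sym (unfold (H ν) (+ sum ν)) ⟩
      offset ν + + 2 * + sum ν         ≡⟨ cong (λ s → offset ν + + 2 * s) size≡ ⟩
      offset ν + + 2 * (+ n - + j)     ≡⟨ distribute (offset ν) (+ n) (+ j) ⟩
      eigen ν - + 2 * + j              ∎)
      where open ≡-Reasoning
            unfold : ∀ h s → (h - + 2 * s) + + 2 * s ≡ h
            unfold = solve-∀
            distribute : ∀ x N J → x + + 2 * (N - J) ≡ (x + + 2 * N) - + 2 * J
            distribute = solve-∀
    ... | no size≢ rewrite Fpow-concentrated j ν ν-ok size≢ =
      trans (ℤ.*-zeroʳ (H ν)) (sym (ℤ.*-zeroʳ (eigen ν - + 2 * + j)))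

    eigen-add : ∀ μ r → Valid μ → r < k → eigen (add r μ) ≡ eigen μ
    eigen-add μ r μ-ok r<k = cong (_+ + 2 * + n) (offset-add r μ-ok r<k)

    E-Fpow : ∀ j ν → Valid ν → E (Fpow (suc j)) ν ≡ (+ suc j * (eigen ν - + j)) * Fpow j ν
    E-Fpow zero ν ν-ok = begin
      E (F v) ν                          ≡⟨ EF-FE v ν-ok ⟩
      F (E v) ν + H ν * v ν              ≡⟨ cong₂ _+_ (F-vanishes (E v) Ev≡0 ν ν-ok) (H-on-Fpow 0 ν ν-ok) ⟩
      + 0 + (eigen ν - + 2 * + 0) * v ν  ≡⟨ simplify (eigen ν) (v ν) ⟩
      (+ 1 * (eigen ν - + 0)) * v ν      ∎
      where open ≡-Reasoning
            simplify : ∀ c x → + 0 + (c - + 2 * + 0) * x ≡ (+ 1 * (c - + 0)) * x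
            simplify = solve-∀
    E-Fpow (suc j) ν ν-ok = begin
      E (F (Fpow (suc j))) ν
        ≡⟨ EF-FE (Fpow (suc j)) ν-ok ⟩
      F (E (Fpow (suc j))) ν + H ν * Fpow (suc j) ν
        ≡⟨ cong₂ _+_ (F-scale (E (Fpow (suc j))) (Fpow j) (λ μ → + suc j * (eigen μ - + j))
                              (λ μ r μ-ok r<k → cong (λ c → + suc j * (c - + j)) (eigen-add μ r μ-ok r<k))
                              (λ ν′ ν′-ok → E-Fpow j ν′ ν′-ok) ν ν-ok)
                     (H-on-Fpow (suc j) ν ν-ok) ⟩
      (+ suc j * (eigen ν - + j)) * Fpow (suc j) ν + (eigen ν - + 2 * + suc j) * Fpow (suc j) ν
        ≡⟨ collect (+ j) (eigen ν) (Fpow (suc j) ν) ⟩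
      (+ suc (suc j) * (eigen ν - + suc j)) * Fpow (suc j) ν ∎
      where open ≡-Reasoning
            collect : ∀ J c x → (+ 1 + J) * (c - J) * x + (c - + 2 * (+ 1 + J)) * x
                                  ≡ ((+ 1 + (+ 1 + J)) * (c - (+ 1 + J))) * x
            collect = solve-∀

    -- eigen ν − j = −(1 + e + D + j) < 0, where offset ν = −e − kM and kM = 2n + 1 + D.
    eigen-nonzero : ∀ ν j → ¬ (eigen ν - + j ≡ + 0)
    eigen-nonzero ν j with offset-≡ ν
    ... | e , offset≡ = λ eigen-j≡0 → negative (trans (sym eigen-j≡) eigen-j≡0)
      where
        open ≡-Reasoning
        D = k *ℕ M ∸ suc (2 *ℕ n)
        kM≡ : + k * + M ≡ + 1 + + 2 * + n + + D
        kM≡ = begin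
          + k * + M                  ≡⟨ sym (ℤ.pos-* k M) ⟩
          + (k *ℕ M)                 ≡⟨ cong +_ (sym (ℕ.m+[n∸m]≡n small)) ⟩
          + (suc (2 *ℕ n) +ℕ D)      ≡⟨ ℤ.pos-+ (suc (2 *ℕ n)) D ⟩
          + 1 + + (2 *ℕ n) + + D     ≡⟨ cong (λ z → + 1 + z + + D) (ℤ.pos-* 2 n) ⟩
          + 1 + + 2 * + n + + D      ∎
        eigen-j≡ : eigen ν - + j ≡ - (+ 1 + (+ e + + D + + j))
        eigen-j≡ = begin
          offset ν + + 2 * + n - + j                        ≡⟨ cong (λ o → o + + 2 * + n - + j) offset≡ ⟩
          - + e - + k * + M + + 2 * + n - + j               ≡⟨ cong (λ z → - + e - z + + 2 * + n - + j) kM≡ ⟩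
          - + e - (+ 1 + + 2 * + n + + D) + + 2 * + n - + j ≡⟨ simplify (+ e) (+ n) (+ D) (+ j) ⟩
          - (+ 1 + (+ e + + D + + j))                       ∎
          where simplify : ∀ e n D j → - e - (+ 1 + + 2 * n + D) + + 2 * n - j ≡ - (+ 1 + (e + D + j))
                simplify = solve-∀
        negative : ¬ (- (+ 1 + (+ e + + D + + j)) ≡ + 0)
        negative ()

    Fpow-vanishes-down : ∀ j → Vanishes (Fpow (suc j)) → Vanishes (Fpow j)
    Fpow-vanishes-down j Fpow₊≡0 ν ν-ok
      with ℤ.i*j≡0⇒i≡0∨j≡0 (+ suc j * (eigen ν - + j))
             (trans (sym (E-Fpow j ν ν-ok)) (E-vanishes (Fpow (suc j)) Fpow₊≡0 ν ν-ok))
    ... | inj₂ Fpow≡0   = Fpow≡0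
    ... | inj₁ scalar≡0 with ℤ.i*j≡0⇒i≡0∨j≡0 (+ suc j) scalar≡0
    ...   | inj₂ eigen-j≡0 = ⊥-elim (eigen-nonzero ν j eigen-j≡0)

    -- F^{n+1} v is concentrated on size −1, which no sequence has.
    Fpow-beyond : Vanishes (Fpow (suc n))
    Fpow-beyond μ μ-ok = Fpow-concentrated (suc n) μ μ-ok (λ size≡ → no-size (trans size≡ (minus-one (+ n))))
      where minus-one : ∀ a → a - (+ 1 + a) ≡ - + 1
            minus-one = solve-∀
            no-size : ¬ (+ sum μ ≡ - + 1)
            no-size ()

    descend : ∀ j → Vanishes (Fpow j) → Vanishes v
    descend zero    v≡0      = v≡0
    descend (suc j) Fpow₊≡0 = descend j (Fpow-vanishes-down j Fpow₊≡0)

  lowest-weight : ∀ n v → ConcentratedOn (+ n) v → Vanishes (E v) → 2 *ℕ n < k *ℕ M → Vanishes v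
  lowest-weight n v v-conc Ev≡0 small = descend (suc n) Fpow-beyond
    where open LowestWeight n v v-conc Ev≡0 small


module Counting where

  open import Data.Nat using (suc; _+_; _∸_; _≟_; _≤?_; z≤n)
  import Data.Nat.Properties as ℕ
  open import Data.List using ([]; _∷_; _++_; map; filter)
  open import Data.List.Properties using (filter-++; length-++; filter-accept; filter-reject)
  open import Data.List.Membership.Propositional using (_∈_)
  open import Data.List.Relation.Unary.Any using (here; there)
  open import Data.Nat.ListAction using (sum)
  open import Relation.Binary.PropositionalEquality
  open import Relation.Nullary using (yes; no; ¬_)
  open import Data.Empty using (⊥-elim)
  open BoundedSequences using (prepend)

  count : List (List ℕ) → ℕ → ℕ
  count L n = length (filter (λ μ → sum μ ≟ n) L)

  count-++ : ∀ L₁ L₂ n → count (L₁ ++ L₂) n ≡ count L₁ n + count L₂ n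
  count-++ L₁ L₂ n = trans (cong length (filter-++ (λ μ → sum μ ≟ n) L₁ L₂)) (length-++ (filter (λ μ → sum μ ≟ n) L₁))

  count-∷-yes : ∀ μ L n → sum μ ≡ n → count (μ ∷ L) n ≡ suc (count L n)
  count-∷-yes μ L n size≡n = cong length (filter-accept (λ μ → sum μ ≟ n) {x = μ} {xs = L} size≡n)

  count-∷-no : ∀ μ L n → ¬ sum μ ≡ n → count (μ ∷ L) n ≡ count L n
  count-∷-no μ L n size≢n = cong length (filter-reject (λ μ → sum μ ≟ n) {x = μ} {xs = L} size≢n)

  shift : ℕ → (ℕ → ℕ) → ℕ → ℕ
  shift x f n with x ≤? n
  ... | yes _ = f (n ∸ x)
  ... | no _  = 0

  count-map-cons : ∀ x L n → count (map (x ∷_) L) n ≡ shift x (count L) n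
  count-map-cons x L n with x ≤? n
  ... | yes x≤n = reached L
    where
      reached : ∀ L → count (map (x ∷_) L) n ≡ count L (n ∸ x)
      reached []      = refl
      reached (μ ∷ L) with sum μ ≟ n ∸ x
      ... | yes size≡ = trans (count-∷-yes (x ∷ μ) (map (x ∷_) L) n (trans (cong (x +_) size≡) (ℕ.m+[n∸m]≡n x≤n)))
                              (trans (cong suc (reached L)) (sym (count-∷-yes μ L (n ∸ x) size≡)))
      ... | no size≢  = trans (count-∷-no (x ∷ μ) (map (x ∷_) L) n
                                (λ size≡ → size≢ (trans (sym (ℕ.m+n∸m≡n x (sum μ))) (cong (_∸ x) size≡))))
                              (trans (reached L) (sym (count-∷-no μ L (n ∸ x) size≢)))
  ... | no x≰n = not-reached L
    where
      not-reached : ∀ L → count (map (x ∷_) L) n ≡ 0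
      not-reached []      = refl
      not-reached (μ ∷ L) = trans (count-∷-no (x ∷ μ) (map (x ∷_) L) n
                                    (λ size≡ → x≰n (subst (x ≤_) size≡ (ℕ.m≤m+n x (sum μ)))))
                                  (not-reached L)

  IncreasingUpTo : ℕ → (ℕ → ℕ) → Set
  IncreasingUpTo c f = ∀ n → suc n ≤ c → f n ≤ f (suc n)

  increasing-cong : ∀ {c f g} → (∀ n → f n ≡ g n) → IncreasingUpTo c f → IncreasingUpTo c g
  increasing-cong f≡g f↑ n n<c = subst₂ _≤_ (f≡g n) (f≡g (suc n)) (f↑ n n<c)

  increasing-mono : ∀ {c d f} → d ≤ c → IncreasingUpTo c f → IncreasingUpTo d f
  increasing-mono d≤c f↑ n n<d = f↑ n (ℕ.≤-trans n<d d≤c)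

  increasing-+ : ∀ {c f g} → IncreasingUpTo c f → IncreasingUpTo c g → IncreasingUpTo c (λ n → f n + g n)
  increasing-+ f↑ g↑ n n<c = ℕ.+-mono-≤ (f↑ n n<c) (g↑ n n<c)

  increasing-shift : ∀ {c f} x → IncreasingUpTo c f → IncreasingUpTo (x + c) (shift x f)
  increasing-shift {c} {f} x f↑ n n<x+c with x ≤? n | x ≤? suc n
  ... | yes x≤n | yes _   = subst (λ m → f (n ∸ x) ≤ f m) (sym (ℕ.+-∸-assoc 1 x≤n)) (f↑ (n ∸ x) within)
    where within : suc (n ∸ x) ≤ c
          within = ℕ.+-cancelˡ-≤ x _ _ (subst (_≤ x + c) (sym (trans (ℕ.+-suc x (n ∸ x)) (cong suc (ℕ.m+[n∸m]≡n x≤n)))) n<x+c)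
  ... | yes x≤n | no x≰1+n = ⊥-elim (x≰1+n (ℕ.m≤n⇒m≤1+n x≤n))
  ... | no _    | _        = z≤n

  increasing-prepend : ∀ {c} S xs → (∀ {x} → x ∈ xs → IncreasingUpTo c (count (map (x ∷_) (S x)))) →
                       IncreasingUpTo c (count (prepend S xs))
  increasing-prepend S []       blocks↑ n _ = z≤n
  increasing-prepend S (x ∷ xs) blocks↑ =
    increasing-cong (λ n → sym (count-++ (map (x ∷_) (S x)) (prepend S xs) n))
      (increasing-+ (blocks↑ (here refl)) (increasing-prepend S xs (λ x∈xs → blocks↑ (there x∈xs))))


-- If
-- among the sequences bounded by (M, λ) there were more of size n than of size
-- n + 1, then the linear map v ↦ (E v on size n + 1), on functions supported on
-- size n, would have a nonzero kernel element v (more unknowns than equations).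
-- But then E v = 0 everywhere, and the lowest-weight lemma forces v = 0.
module BoxInequality (M k : ℕ) (ls : List ℕ) (k≤len : k ≤ length ls) (wide : ∀ i → i < k → M ≤ get ls i) where

  open import Data.Nat using (suc; _≟_; _≤?_) renaming (_*_ to _*ℕ_)
  import Data.Nat.Properties as ℕ
  open import Data.Integer using (ℤ; +_; _+_; _*_)
  import Data.Integer.Properties as ℤ
  open import Data.Integer.Tactic.RingSolver using (solve-∀)
  open import Data.List using ([]; _∷_; map; filter)
  open import Data.List.Properties using (length-map; map-∘; ≡-dec)
  open import Data.List.Relation.Unary.Any using (here; there)
  open import Data.List.Relation.Unary.All using (lookup)
  open import Data.List.Relation.Unary.Unique.Propositional using (Unique; _∷_)
  import Data.List.Relation.Unary.Unique.Propositional.Properties as Unique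
  open import Data.List.Membership.Propositional using (_∈_)
  open import Data.List.Membership.Propositional.Properties using (∈-filter⁺; ∈-filter⁻)
  open import Data.Nat.ListAction using (sum)
  open import Data.Product using (Σ; _,_; _×_; proj₁; proj₂)
  open import Data.Empty using (⊥; ⊥-elim)
  open import Relation.Binary.PropositionalEquality
  open import Relation.Nullary using (yes; no; ¬_)
  open IntegerSums
  open import Defs using (boundedSeqs)
  open BoundedSequences using (bounded⇒∈; ∈⇒bounded; unique-boundedSeqs)
  open LinearRelations {List ℕ}
  open Counting using (count)
  open BoxAction M k ls k≤len wide

  point : List ℕ → List ℕ → ℤ
  point τ μ = indicator (≡-dec _≟_ μ τ)

  E-combination : ∀ β gs μ → E (combination β gs) μ ≡ combination β (map E gs) μ
  E-combination []      gs       μ = sumBelow-zero k (λ r _ → ℤ.*-zeroʳ (indicator (removable? r μ)))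
  E-combination (a ∷ β) []       μ = sumBelow-zero k (λ r _ → ℤ.*-zeroʳ (indicator (removable? r μ)))
  E-combination (a ∷ β) (g ∷ gs) μ =
    trans (sumBelow-cong k (λ r _ → distribute (indicator (removable? r μ)) a (g (remove r μ)) (combination β gs (remove r μ))))
    (trans (sumBelow-+ k _ _) (cong₂ _+_ (sumBelow-*ˡ k a _) (E-combination β gs μ)))
    where distribute : ∀ i a x y → i * (a * x + y) ≡ a * (i * x) + i * y
          distribute = solve-∀

  combination-points-away : ∀ β τs μ → (∀ {τ} → τ ∈ τs → ¬ μ ≡ τ) → combination β (map point τs) μ ≡ + 0
  combination-points-away []      τs       μ _   = refl
  combination-points-away (a ∷ β) []       μ _   = refl
  combination-points-away (a ∷ β) (τ ∷ τs) μ μ∉ with ≡-dec _≟_ μ τ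
  ... | yes μ≡τ = ⊥-elim (μ∉ (here refl) μ≡τ)
  ... | no _    = trans (cong (λ z → a * + 0 + z) (combination-points-away β τs μ (λ τ∈τs → μ∉ (there τ∈τs))))
                        (trans (ℤ.+-identityʳ _) (ℤ.*-zeroʳ a))

  nontrivial-at-some-point : ∀ β τs → length β ≡ length τs → Unique τs → Nontrivial β →
    Σ (List ℕ) λ τ → τ ∈ τs × ¬ combination β (map point τs) τ ≡ + 0
  nontrivial-at-some-point (a ∷ β) (τ ∷ τs) _ (τ∉τs ∷ _) (here a≢0) =
    τ , here refl , λ value≡0 → a≢0 (trans (sym value≡a) value≡0)
    where
      value≡a : combination (a ∷ β) (map point (τ ∷ τs)) τ ≡ a
      value≡a rewrite indicator-yes (≡-dec _≟_ τ τ) refl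
                    | combination-points-away β τs τ (λ τ′∈τs τ≡τ′ → lookup τ∉τs τ′∈τs τ≡τ′)
              = trans (ℤ.+-identityʳ _) (ℤ.*-identityʳ a)
  nontrivial-at-some-point (a ∷ β) (τ ∷ τs) len (τ∉τs ∷ τs-uniq) (there β≢0)
    with nontrivial-at-some-point β τs (ℕ.suc-injective len) τs-uniq β≢0
  ... | τ′ , τ′∈τs , value≢0 = τ′ , there τ′∈τs , λ value≡0 → value≢0 (trans (sym drop-head) value≡0)
    where
      drop-head : combination (a ∷ β) (map point (τ ∷ τs)) τ′ ≡ combination β (map point τs) τ′
      drop-head with ≡-dec _≟_ τ′ τ
      ... | yes τ′≡τ = ⊥-elim (lookup τ∉τs τ′∈τs (sym τ′≡τ))
      ... | no _     = trans (cong (_+ combination β (map point τs) τ′) (ℤ.*-zeroʳ a)) (ℤ.+-identityˡ _)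

  box-inequality : ∀ n → 2 *ℕ n < k *ℕ M → count (boundedSeqs M ls) n ≤ count (boundedSeqs M ls) (suc n)
  box-inequality n small with count (boundedSeqs M ls) n ≤? count (boundedSeqs M ls) (suc n)
  ... | yes fewer = fewer
  ... | no too-many =
    ⊥-elim (no-kernel (nontrivial-relation equations Bs (subst (length Bs <_) (sym (length-map _ As)) (ℕ.≰⇒> too-many))))
    where
      As Bs : List (List ℕ)
      As = filter (λ μ → sum μ ≟ n) (boundedSeqs M ls)
      Bs = filter (λ μ → sum μ ≟ suc n) (boundedSeqs M ls)

      ∈As⁻ : ∀ {τ} → τ ∈ As → τ ∈ boundedSeqs M ls × sum τ ≡ n
      ∈As⁻ = ∈-filter⁻ (λ μ → sum μ ≟ n) {xs = boundedSeqs M ls}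

      -- One unknown per τ ∈ As and one equation per ν ∈ Bs: (E point_τ)(ν).
      equations : List (List ℕ → ℤ)
      equations = map (λ τ → E (point τ)) As

      no-kernel : Relation equations Bs → ⊥
      no-kernel (α , lenα , α≢0 , α-solves) with nontrivial-at-some-point α As (trans lenα (length-map _ As))
                                                  (Unique.filter⁺ _ (unique-boundedSeqs M ls)) α≢0
      ... | τ , τ∈As , vτ≢0 = vτ≢0 (v≡0 τ (∈⇒bounded M ls (proj₁ (∈As⁻ τ∈As))))
        where
          -- v = Σ_τ α_τ point_τ, a nonzero function supported on size n …
          v : List ℕ → ℤ
          v = combination α (map point As)

          v-conc : ConcentratedOn (+ n) v
          v-conc μ _ size≢ = combination-points-away α As μ
            (λ τ∈As μ≡τ → size≢ (cong +_ (trans (cong sum μ≡τ) (proj₂ (∈As⁻ τ∈As)))))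

          -- … with E v = 0: on size n + 1 by the choice of α, elsewhere by support.
          Ev≡0 : Vanishes (E v)
          Ev≡0 μ μ-ok with sum μ ≟ suc n
          ... | yes size≡ = trans (E-combination α (map point As) μ)
                             (trans (cong (λ gs → combination α gs μ) (sym (map-∘ As)))
                                    (α-solves (∈-filter⁺ (λ μ → sum μ ≟ suc n) (bounded⇒∈ M ls μ-ok) size≡)))
          ... | no size≢  = E-concentrated (+ n) v v-conc μ μ-ok
                              (λ size≡ → size≢ (trans (ℤ.+-injective size≡) (ℕ.+-comm n 1)))

          v≡0 : Vanishes v
          v≡0 = lowest-weight n v v-conc Ev≡0 small


-- Split the sequences bounded by (b, λ) by their first entry x: those
-- with x ≤ M are bounded by (M, λ) and handled by the box inequality; for each
-- x > M the rest is bounded by (x, λ without its first entry), whose count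
-- increases up to ⌈(k−1)M/2⌉ by induction on k, so after shifting by x it
-- increases up to x + ⌈(k−1)M/2⌉ ≥ ⌈kM/2⌉.
module Reduction where

  open import Data.Nat using (zero; suc; _+_; _*_; _∸_; _⊓_; ⌈_/2⌉; z≤n; s≤s)
  import Data.Nat.Properties as ℕ
  open import Data.List using (_∷_; _++_; map; upTo; applyUpTo)
  open import Data.List.Membership.Propositional using (_∈_)
  open import Data.List.Properties using (concatMap-++)
  open import Data.List.Membership.Propositional.Properties using (∈-applyUpTo⁻)
  open import Data.Product using (_,_)
  open import Relation.Binary.PropositionalEquality
  open import Defs using (boundedSeqs)
  open BoundedSequences using (prepend)
  open Counting

  below-half : ∀ x n → suc n ≤ ⌈ x /2⌉ → 2 * n < x
  below-half (suc zero)    zero    _       = s≤s z≤n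
  below-half (suc zero)    (suc n) (s≤s ())
  below-half (suc (suc x)) zero    _       = s≤s z≤n
  below-half (suc (suc x)) (suc n) (s≤s p) =
    subst (_< suc (suc x)) (sym (ℕ.+-suc (suc n) (n + 0))) (s≤s (s≤s (below-half x n p)))

  half-suc : ∀ y → ⌈ suc y /2⌉ ≤ suc ⌈ y /2⌉
  half-suc zero          = s≤s z≤n
  half-suc (suc zero)    = s≤s z≤n
  half-suc (suc (suc y)) = s≤s (half-suc y)

  half-+ : ∀ a b → ⌈ b + a /2⌉ ≤ b + ⌈ a /2⌉
  half-+ a zero    = ℕ.≤-refl
  half-+ a (suc b) = ℕ.≤-trans (half-suc (b + a)) (s≤s (half-+ a b))

  applyUpTo-+ : ∀ (f : ℕ → ℕ) m d → applyUpTo f (m + d) ≡ applyUpTo f m ++ applyUpTo (λ i → f (m + i)) d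
  applyUpTo-+ f zero    d = refl
  applyUpTo-+ f (suc m) d = cong (f 0 ∷_) (applyUpTo-+ (λ i → f (suc i)) m d)

  increasing-bounded : ∀ k M b ls → M ≤ b → k ≤ length ls → (∀ i → i < k → M ≤ get ls i) →
                       IncreasingUpTo ⌈ k * M /2⌉ (count (boundedSeqs b ls))
  increasing-bounded zero    M b ls       _   _              _    n ()
  increasing-bounded (suc k) M b (l ∷ ls) M≤b (s≤s k≤len) wide =
    increasing-cong (λ n → sym (trans (cong (λ L → count L n) split) (count-++ (boundedSeqs M (l ∷ ls)) (prepend S tall) n)))
      (increasing-+ box-part (increasing-prepend S tall tall-block))
    where
      S : ℕ → List (List ℕ)
      S x = boundedSeqs x ls

      M≤l : M ≤ l
      M≤l = wide 0 (s≤s z≤n)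

      -- the first entries x with M < x ≤ b ⊓ l
      tall : List ℕ
      tall = applyUpTo (suc M +_) (b ⊓ l ∸ M)

      split : boundedSeqs b (l ∷ ls) ≡ boundedSeqs M (l ∷ ls) ++ prepend S tall
      split = begin
        prepend S (upTo (suc (b ⊓ l)))
          ≡⟨ cong (λ m → prepend S (upTo (suc m))) (sym (ℕ.m+[n∸m]≡n (ℕ.⊓-glb M≤b M≤l))) ⟩
        prepend S (upTo (suc M + (b ⊓ l ∸ M)))
          ≡⟨ cong (prepend S) (applyUpTo-+ (λ i → i) (suc M) (b ⊓ l ∸ M)) ⟩
        prepend S (upTo (suc M) ++ tall)
          ≡⟨ concatMap-++ (λ x → map (x ∷_) (S x)) (upTo (suc M)) tall ⟩
        prepend S (upTo (suc M)) ++ prepend S tall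
          ≡⟨ cong (λ m → prepend S (upTo (suc m)) ++ prepend S tall) (sym (ℕ.m≤n⇒m⊓n≡m M≤l)) ⟩
        boundedSeqs M (l ∷ ls) ++ prepend S tall
          ∎
        where open ≡-Reasoning

      box-part : IncreasingUpTo ⌈ suc k * M /2⌉ (count (boundedSeqs M (l ∷ ls)))
      box-part n n<half = BoxInequality.box-inequality M (suc k) (l ∷ ls) (s≤s k≤len) wide n (below-half _ n n<half)

      tall-block : ∀ {x} → x ∈ tall → IncreasingUpTo ⌈ suc k * M /2⌉ (count (map (x ∷_) (S x)))
      tall-block {x} x∈tall with ∈-applyUpTo⁻ (suc M +_) x∈tall
      ... | i , _ , refl =
        increasing-cong (λ n → sym (count-map-cons x (S x) n))
          (increasing-mono (ℕ.≤-trans (half-+ (k * M) M) (ℕ.+-monoˡ-≤ ⌈ k * M /2⌉ M≤x))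
            (increasing-shift x (increasing-bounded k M x ls M≤x k≤len (λ j j<k → wide (suc j) (s≤s j<k)))))
        where M≤x : M ≤ x
              M≤x = ℕ.≤-trans (ℕ.n≤1+n M) (ℕ.m≤m+n (suc M) i)


module Partitions where

  open import Data.Nat using (zero; suc; _≥_; z≤n; s≤s)
  import Data.Nat.Properties as ℕ
  open import Data.List using ([]; _∷_)
  open import Data.List.Relation.Unary.Linked using (Linked; []; [-]; _∷_)
  open import Data.Sum using (inj₁; inj₂)
  open import Relation.Binary.PropositionalEquality using (_≡_; refl)
  open import Defs using (part)

  part-get : ∀ xs j → part xs (suc j) ≡ get xs j
  part-get []       j       = refl
  part-get (x ∷ xs) zero    = refl
  part-get (x ∷ xs) (suc j) = part-get xs j

  get-beyond : ∀ xs j → length xs ≤ j → get xs j ≡ 0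
  get-beyond []       j       _       = refl
  get-beyond (x ∷ xs) (suc j) (s≤s p) = get-beyond xs j p

  get-antitone : ∀ {xs} → Linked _≥_ xs → ∀ {i j} → i ≤ j → get xs j ≤ get xs i
  get-antitone sorted {i} {zero}  z≤n   = ℕ.≤-refl
  get-antitone sorted {i} {suc j} i≤1+j with ℕ.m≤n⇒m<n∨m≡n i≤1+j
  ... | inj₁ i<1+j = ℕ.≤-trans (step sorted j) (get-antitone sorted (ℕ.≤-pred i<1+j))
    where step : ∀ {xs} → Linked _≥_ xs → ∀ j → get xs (suc j) ≤ get xs j
          step []               j       = z≤n
          step [-]              j       = z≤n
          step (x≥y ∷ _)        zero    = x≥y
          step (_   ∷ sorted′)  (suc j) = step sorted′ j
  ... | inj₂ refl  = ℕ.≤-refl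


open import Data.Nat using (suc; _*_; _≥_; ⌈_/2⌉; z≤n; _≤?_)
import Data.Nat.Properties as ℕ
open import Data.List using (_∷_; upTo)
open import Data.List.Relation.Unary.Linked using (Linked)
open import Data.Product using (_,_)
open import Data.Empty using (⊥-elim)
open import Relation.Binary.PropositionalEquality using (_≡_; cong; subst; sym; trans)
open import Relation.Nullary using (yes; no; ¬_)
open import Defs
open BoundedSequences using (prepend)
open Counting using (IncreasingUpTo; count)
open Reduction using (increasing-bounded)
open Partitions

subPartitions-bounded : ∀ l ls → subPartitions (l ∷ ls) ≡ boundedSeqs l (l ∷ ls)
subPartitions-bounded l ls = cong (λ m → prepend (λ x → boundedSeqs x ls) (upTo (suc m))) (sym (ℕ.⊓-idem l))

-- The theorem for k = j + 1 at most the number of parts, where λ_k = get λ j.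
coeff-increasing : ∀ λs → Linked _≥_ λs → ∀ j → suc j ≤ length λs → IncreasingUpTo ⌈ suc j * get λs j /2⌉ (coeff λs)
coeff-increasing (l ∷ ls) sorted j k≤len =
  subst (λ L → IncreasingUpTo ⌈ suc j * get (l ∷ ls) j /2⌉ (count L)) (sym (subPartitions-bounded l ls))
    (increasing-bounded (suc j) (get (l ∷ ls) j) l (l ∷ ls) (get-antitone sorted {0} {j} z≤n) k≤len
      (λ i i<k → get-antitone sorted {i} {j} (ℕ.≤-pred i<k)))

mainTheorem8 : (λs : List ℕ) → IsPartition λs → (k : ℕ) → 1 ≤ k →
    (n : ℕ) → suc n ≤ ⌈ k * part λs k /2⌉ → coeff λs n ≤ coeff λs (suc n)
mainTheorem8 λs (sorted , _) (suc j) _ n n<bound with suc j ≤? length λs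
... | yes k≤len = coeff-increasing λs sorted j k≤len n (subst (λ M → suc n ≤ ⌈ suc j * M /2⌉) (part-get λs j) n<bound)
... | no  k>len = ⊥-elim (no-room (subst (λ M → suc n ≤ ⌈ suc j * M /2⌉) part≡0 n<bound))
  where
    -- with fewer than k parts, λ_k = 0 and the range is empty
    part≡0 : part λs (suc j) ≡ 0
    part≡0 = trans (part-get λs j) (get-beyond λs j (ℕ.≤-pred (ℕ.≰⇒> k>len)))
    no-room : ¬ suc n ≤ ⌈ suc j * 0 /2⌉
    no-room rewrite ℕ.*-zeroʳ j = λ ()
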